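{- Let $p,q\in\mathbb{N}$. Let $\lambda=(\lambda_1,\ldots,\lambda_q)$ and $\mu=(\mu_1,\ldots,\mu_q)$ be partitions (entries may be $0$) whose conjugates can be written as $\lambda'=(\lambda'_1,\ldots,\lambda'_p)$ and $\mu'=(\mu'_1,\ldots,\mu'_p)$ (entries may be $0$). Let $K$ be a commutative ring, let $B=(b_{i,j})_{i,j\in\mathbb{Z}}$ be an upper unitriangular matrix over $K$ indexed by $\mathbb{Z}$, and let $(c_{i,j})_{i,j\in\mathbb{Z}}=B^{ -1}$. Then \[\det\left(b_{\mu_i-i,\ \lambda_j-j}\right)_{i,j\in[q]}=(-1)^{(\lambda_1+\cdots+\lambda_q)+(\mu_1+\cdots+\mu_q)}\det\left(c_{i-\lambda'_i-1,\ j-\mu'_j-1}\right)_{i,j\in[p]}.\]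
   Context: $[r]=\{1,\ldots,r\}$. The conjugate partition $\lambda'$ of $\lambda$ is obtained by transposing its Young diagram; writing $\lambda'=(\lambda'_1,\ldots,\lambda'_p)$ means $\lambda_1\le p$, and writing $\lambda=(\lambda_1,\ldots,\lambda_q)$ means $\lambda$ has at most $q$ nonzero parts. Upper unitriangular $\mathbb{Z}\times\mathbb{Z}$-matrices form a group under multiplication. -}

module Defs where

open import Level using (Level)
open import Algebra.Bundles using (CommutativeRing)
open import Data.Nat as ℕ using (ℕ; zero; suc)
open import Data.Fin as Fin using (Fin; zero; suc; toℕ)
open import Data.Integer as ℤ using (ℤ; +_)
open import Data.Product using (_×_)
open import Data.Bool using (Bool; true; false; if_then_else_)
open import Relation.Nullary.Decidable using (⌊_⌋)

countFin : ∀ {q} → (Fin q → Bool) → ℕ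
countFin {zero}  P = 0
countFin {suc q} P = (if P zero then 1 else 0) ℕ.+ countFin (λ j → P (suc j))

sumFin : ∀ {q} → (Fin q → ℕ) → ℕ
sumFin {zero}  f = 0
sumFin {suc q} f = f zero ℕ.+ sumFin (λ j → f (suc j))

-- λ : Fin q → ℕ  (λ_{k+1} = λ k) is a partition with (at most) q parts,
-- zero entries allowed: weakly decreasing.
IsPartition : ∀ {q} → (Fin q → ℕ) → Set
IsPartition {q} λ′ = ∀ (i j : Fin q) → i Fin.≤ j → λ′ j ℕ.≤ λ′ i

-- The first p entries of the conjugate partition:
-- conj p λ k = λ'_{k+1} = #{ j ∈ [q] : λ_j ≥ k+1 }.
conj : ∀ {q} (p : ℕ) → (Fin q → ℕ) → Fin p → ℕ
conj p λ′ k = countFin (λ j → ⌊ suc (toℕ k) ℕ.≤? λ′ j ⌋)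

module _ {c ℓ : Level} (K : CommutativeRing c ℓ) where
  open CommutativeRing K using (Carrier; _≈_; _+_; _*_; -_; 0#; 1#)

  neg1^ : ℕ → Carrier
  neg1^ zero    = 1#
  neg1^ (suc n) = - 1# * neg1^ n

  sumK : ∀ n → (Fin n → Carrier) → Carrier
  sumK zero    f = 0#
  sumK (suc n) f = f zero + sumK n (λ k → f (suc k))

  det : ∀ n → (Fin n → Fin n → Carrier) → Carrier
  det zero    A = 1#
  det (suc n) A =
    sumK (suc n) (λ j → neg1^ (toℕ j) * (A zero j * det n (λ r s → A (suc r) (Fin.punchIn j s))))

  sumUpTo : ℕ → (ℕ → Carrier) → Carrier
  sumUpTo zero    f = f 0
  sumUpTo (suc n) f = sumUpTo n f + f (suc n)

  ZMatrix : Set c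
  ZMatrix = ℤ → ℤ → Carrier

  IsUpperUnitriangular : ZMatrix → Set ℓ
  IsUpperUnitriangular B =
    (∀ i j → j ℤ.< i → B i j ≈ 0#) × (∀ i → B i i ≈ 1#)

  -- Kronecker delta for j = i + n
  δ : ℕ → Carrier
  δ zero    = 1#
  δ (suc _) = 0#

  -- For upper triangular B, C the (i, i+n) entry of BC is the finite sum
  -- Σ_{t=0}^{n} b_{i,i+t} c_{i+t,i+n}; entries (i,j) with j < i vanish.
  -- B C = I (restricted to the only nontrivial entries).
  ProductIsId : ZMatrix → ZMatrix → Set ℓ
  ProductIsId B C = ∀ (i : ℤ) (n : ℕ) →
    sumUpTo n (λ t → B i (i ℤ.+ + t) * C (i ℤ.+ + t) (i ℤ.+ + n)) ≈ δ n

  IsInverse : ZMatrix → ZMatrix → Set ℓ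
  IsInverse B C = IsUpperUnitriangular C × ProductIsId B C × ProductIsId C B

{-# OPTIONS --safe #-}

-- Put N = q + p, A = (b (u - q) (v - q)) and A′ = (c (u - q) (v - q)) for u, v < N; then A′ A = 1 and
-- det A′ = 1 since B and C are unitriangular. The numbers λⱼ - j - 1 + q (j < q) and k - λ′ₖ + q (k < p)
-- are the values of a permutation σ_λ of [0, N). Let Y have the columns A e(σ_λ j) for j < q and the unit
-- columns e(σ_μ (q + k)) for k < p. Permuting the rows of Y by σ_μ gives a block triangular matrix with
-- diagonal blocks the left-hand minor and 1, and permuting the rows of A′ Y by σ_λ gives one with diagonal
-- blocks 1 and the right-hand minor. So both minors are det Y up to the signs of σ_μ and σ_λ, and removing
-- a corner box of λ composes σ_λ with a transposition, whence sign σ_λ = (-1)^|λ| sign σ_∅.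
-- Multiplicativity of the Laplace-expansion determinant comes from the uniqueness of alternating
-- multilinear forms.

module Submission where

open import Defs
open import Level using (Level; _⊔_)
open import Algebra.Bundles using (CommutativeRing)
open import Data.Nat as ℕ using (ℕ; suc)
open import Data.Fin as Fin using (Fin; toℕ)
open import Data.Integer as ℤ using (ℤ; +_)

open import Data.Nat using (zero; _∸_; z≤n; s≤s)
import Data.Nat.Properties as ℕₚ
open import Data.Fin using (zero; suc; punchIn; punchOut; fromℕ<; _↑ˡ_; _↑ʳ_; splitAt; _≟_)
import Data.Fin.Properties as Finₚ
open import Data.Fin.Properties using (punchInᵢ≢i; punchIn-punchOut; punchOut-punchIn; punchOut-cong; suc-injective)
open import Data.Fin.Permutation.Components using (transpose; transpose-inverse)
open import Data.Vec.Functional using (removeAt; insertAt; updateAt)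
open import Data.Vec.Functional.Properties using (updateAt-updates; updateAt-minimal; insertAt-lookup; insertAt-punchIn)
open import Data.Empty using (⊥-elim)
open import Data.Bool using (Bool; true; false; if_then_else_)
open import Data.Product using (_×_; _,_; ∃₂; proj₁; proj₂)
open import Data.Sum using ([_,_]′)
open import Function using (_∘_; const)
open import Function.Definitions using (Injective)
open import Relation.Nullary using (Dec; yes; no; ¬_)
open import Relation.Nullary.Decidable using (⌊_⌋; isYes≗does; dec-true; dec-false)
open import Relation.Binary.PropositionalEquality as ≡ using (_≡_; _≢_)
import Data.Integer.Properties as ℤₚ
open import Data.Integer.Solver using (module +-*-Solver)

punchIn-punchOut-comm : ∀ {n} {i j : Fin (suc (suc n))} (i≢j : i ≢ j) (j≢i : j ≢ i) (t : Fin n) →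
  punchIn i (punchIn (punchOut i≢j) t) ≡ punchIn j (punchIn (punchOut j≢i) t)
punchIn-punchOut-comm {i = zero}  {zero}  i≢j _ t = ⊥-elim (i≢j ≡.refl)
punchIn-punchOut-comm {i = zero}  {suc j} _   _ t = ≡.refl
punchIn-punchOut-comm {i = suc i} {zero}  _   _ t = ≡.refl
punchIn-punchOut-comm {suc n} {suc i} {suc j} _ _ zero = ≡.refl
punchIn-punchOut-comm {suc n} {suc i} {suc j} i≢j j≢i (suc t) =
  ≡.cong suc (punchIn-punchOut-comm (i≢j ∘ ≡.cong suc) (j≢i ∘ ≡.cong suc) t)
punchIn-punchOut-comm {zero} {suc zero} {suc zero} i≢j _ ()

transpose-matchˡ : ∀ {n} (i j : Fin n) → transpose i j i ≡ j
transpose-matchˡ i j with i ≟ i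
... | yes _   = ≡.refl
... | no i≢i = ⊥-elim (i≢i ≡.refl)

transpose-matchʳ : ∀ {n} (i j : Fin n) → transpose i j j ≡ i
transpose-matchʳ i j with j ≟ i
... | yes j≡i = j≡i
... | no _ with j ≟ j
...   | yes _   = ≡.refl
...   | no j≢j = ⊥-elim (j≢j ≡.refl)

transpose-others : ∀ {n} {i j k : Fin n} → k ≢ i → k ≢ j → transpose i j k ≡ k
transpose-others {i = i} {j} {k} k≢i k≢j with k ≟ i
... | yes k≡i = ⊥-elim (k≢i k≡i)
... | no _ with k ≟ j
...   | yes k≡j = ⊥-elim (k≢j k≡j)
...   | no _    = ≡.refl

≗-byCases : ∀ {a} {A : Set a} {n} {f g : Fin n → A} (i j : Fin n) → f i ≡ g i → f j ≡ g j →
  (∀ k → k ≢ i → k ≢ j → f k ≡ g k) → ∀ k → f k ≡ g k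
≗-byCases i j fᵢ fⱼ others k with k ≟ i | k ≟ j
... | yes ≡.refl | _          = fᵢ
... | no _       | yes ≡.refl = fⱼ
... | no k≢i     | no k≢j     = others k k≢i k≢j

data PunchInView {n} (j : Fin (suc n)) : Fin (suc n) → Set where
  at      : PunchInView j j
  punched : ∀ t → PunchInView j (punchIn j t)

punchInView : ∀ {n} (j k : Fin (suc n)) → PunchInView j k
punchInView j k with j ≟ k
... | yes ≡.refl = at
... | no j≢k     = ≡.subst (PunchInView j) (punchIn-punchOut j≢k) (punched (punchOut j≢k))

data SplitAtView (m n : ℕ) : Fin (m ℕ.+ n) → Set where
  left  : ∀ i → SplitAtView m n (i ↑ˡ n)
  right : ∀ k → SplitAtView m n (m ↑ʳ k)

splitAtView : ∀ m n r → SplitAtView m n r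
splitAtView zero    n r       = right r
splitAtView (suc m) n zero    = left zero
splitAtView (suc m) n (suc r) with splitAtView m n r
... | left i  = left (suc i)
... | right k = right k

punchIn-↑ˡ : ∀ {m} n (i : Fin (suc m)) (s : Fin m) → punchIn (i ↑ˡ n) (s ↑ˡ n) ≡ punchIn i s ↑ˡ n
punchIn-↑ˡ n zero    s       = ≡.refl
punchIn-↑ˡ n (suc i) zero    = ≡.refl
punchIn-↑ˡ n (suc i) (suc s) = ≡.cong suc (punchIn-↑ˡ n i s)

punchIn-↑ʳ : ∀ {m n} (i : Fin (suc m)) (k : Fin n) → punchIn (i ↑ˡ n) (m ↑ʳ k) ≡ suc m ↑ʳ k
punchIn-↑ʳ          zero    k = ≡.refl
punchIn-↑ʳ {suc m} (suc i) k = ≡.cong suc (punchIn-↑ʳ i k)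

↑ˡ≢↑ʳ : ∀ {m n} (i : Fin m) (k : Fin n) → i ↑ˡ n ≢ m ↑ʳ k
↑ˡ≢↑ʳ {m} {n} i k i↑ˡn≡m↑ʳk = ℕₚ.<⇒≢ (ℕₚ.<-≤-trans (Finₚ.toℕ<n i) (ℕₚ.m≤m+n m (toℕ k)))
  (≡.trans (≡.sym (Finₚ.toℕ-↑ˡ i n)) (≡.trans (≡.cong toℕ i↑ˡn≡m↑ʳk) (Finₚ.toℕ-↑ʳ m k)))

-- Determinants

module Determinant {c ℓ : Level} (K : CommutativeRing c ℓ) where

  open CommutativeRing K hiding (zero)
  open import Algebra.Properties.Ring ring
    using (-‿distribˡ-*; -‿distribʳ-*; -‿involutive; -0#≈0#; -1*x≈-x; +-inverseˡ-unique)
  open import Algebra.Properties.Semiring.Sum semiring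
    using (sum; sum-cong-≋; sum-remove; ∑-distrib-+; *-distribˡ-sum; *-distribʳ-sum; sum-replicate-zero)
  open import Algebra.Solver.Ring.NaturalCoefficients.Default commutativeSemiring
    using (solve; _:+_; _:*_; _:=_)
  open import Relation.Binary.Reasoning.Setoid setoid

  Matrix : ℕ → Set c
  Matrix n = Fin n → Fin n → Carrier

  infix 4 _≈ᴹ_
  _≈ᴹ_ : ∀ {n} → Matrix n → Matrix n → Set ℓ
  X ≈ᴹ Y = ∀ i j → X i j ≈ Y i j

  sign : ℕ → Carrier
  sign = neg1^ K

  minor : ∀ {n} → Matrix (suc n) → Fin (suc n) → Matrix n
  minor A j r = removeAt (A (suc r)) j

  laplaceTerm : ∀ {n} → Matrix (suc n) → Fin (suc n) → Carrier
  laplaceTerm {n} A j = sign (toℕ j) * (A zero j * det K n (minor A j))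

  -- Opaque, so that unification does not unfold sums over Fin (suc n).
  opaque
    ∑ : ∀ {n} → (Fin n → Carrier) → Carrier
    ∑ = sum

    sumK≡∑ : ∀ n (f : Fin n → Carrier) → sumK K n f ≡ ∑ f
    sumK≡∑ zero    f = ≡.refl
    sumK≡∑ (suc n) f = ≡.cong (λ x → f zero + x) (sumK≡∑ n (f ∘ suc))

    ∑-suc : ∀ {n} (f : Fin (suc n) → Carrier) → ∑ f ≡ f zero + ∑ (f ∘ suc)
    ∑-suc f = ≡.refl

    ∑-cong : ∀ {n} {f g : Fin n → Carrier} → (∀ k → f k ≈ g k) → ∑ f ≈ ∑ g
    ∑-cong = sum-cong-≋

    ∑-zero : ∀ {n} {f : Fin n → Carrier} → (∀ k → f k ≈ 0#) → ∑ f ≈ 0#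
    ∑-zero {n} f≈0 = trans (sum-cong-≋ f≈0) (sum-replicate-zero n)

    ∑-remove : ∀ {n} (f : Fin (suc n) → Carrier) (j : Fin (suc n)) → ∑ f ≈ f j + ∑ (f ∘ punchIn j)
    ∑-remove f j = sum-remove {i = j} f

    ∑-+ : ∀ {n} (f g : Fin n → Carrier) → ∑ (λ k → f k + g k) ≈ ∑ f + ∑ g
    ∑-+ = ∑-distrib-+

    *-distribˡ-∑ : ∀ {n} x (f : Fin n → Carrier) → x * ∑ f ≈ ∑ (λ k → x * f k)
    *-distribˡ-∑ = *-distribˡ-sum

    *-distribʳ-∑ : ∀ {n} x (f : Fin n → Carrier) → ∑ f * x ≈ ∑ (λ k → f k * x)
    *-distribʳ-∑ = *-distribʳ-sum

    ∑-splitAt : ∀ m n (f : Fin (m ℕ.+ n) → Carrier) → ∑ f ≈ ∑ (λ i → f (i ↑ˡ n)) + ∑ (λ k → f (m ↑ʳ k))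
    ∑-splitAt zero    n f = sym (+-identityˡ _)
    ∑-splitAt (suc m) n f = trans (+-congˡ (∑-splitAt m n (f ∘ suc))) (sym (+-assoc _ _ _))

  det-expand : ∀ n (A : Matrix (suc n)) → det K (suc n) A ≡ ∑ (laplaceTerm A)
  det-expand n A = sumK≡∑ (suc n) (laplaceTerm A)

  ∑-delta : ∀ {n} {f : Fin (suc n) → Carrier} (j : Fin (suc n)) → (∀ k → k ≢ j → f k ≈ 0#) → ∑ f ≈ f j
  ∑-delta {f = f} j f≈0 = begin
    ∑ f                     ≈⟨ ∑-remove f j ⟩
    f j + ∑ (f ∘ punchIn j) ≈⟨ +-congˡ (∑-zero (λ s → f≈0 _ (punchInᵢ≢i j s))) ⟩
    f j + 0#                ≈⟨ +-identityʳ _ ⟩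
    f j                     ∎

  ∑-linear : ∀ {n} α {f g h : Fin n → Carrier} → (∀ k → f k ≈ α * g k + h k) → ∑ f ≈ α * ∑ g + ∑ h
  ∑-linear α {f} {g} {h} eq = begin
    ∑ f                           ≈⟨ ∑-cong eq ⟩
    ∑ (λ k → α * g k + h k)       ≈⟨ ∑-+ (λ k → α * g k) h ⟩
    ∑ (λ k → α * g k) + ∑ h       ≈⟨ +-congʳ (*-distribˡ-∑ α g) ⟨
    α * ∑ g + ∑ h                 ∎

  sign-+ : ∀ a b → sign (a ℕ.+ b) ≈ sign a * sign b
  sign-+ zero    b = sym (*-identityˡ _)
  sign-+ (suc a) b = trans (*-congˡ (sign-+ a b)) (sym (*-assoc _ _ _))

  sign-suc : ∀ a → sign (suc a) ≈ - sign a
  sign-suc a = -1*x≈-x (sign a)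

  sign-square : ∀ a → sign a * sign a ≈ 1#
  sign-square zero    = *-identityˡ 1#
  sign-square (suc a) = begin
    sign (suc a) * sign (suc a) ≈⟨ *-cong (sign-suc a) (sign-suc a) ⟩
    - sign a * - sign a         ≈⟨ -‿distribˡ-* _ _ ⟨
    - (sign a * - sign a)       ≈⟨ -‿cong (-‿distribʳ-* _ _) ⟨
    - - (sign a * sign a)       ≈⟨ -‿involutive _ ⟩
    sign a * sign a             ≈⟨ sign-square a ⟩
    1#                          ∎

  sign-+-cancelˡ : ∀ a b x → sign (a ℕ.+ b) * (sign a * x) ≈ sign b * x
  sign-+-cancelˡ a b x = begin
    sign (a ℕ.+ b) * (sign a * x)     ≈⟨ *-congʳ (sign-+ a b) ⟩
    (sign a * sign b) * (sign a * x)  ≈⟨ solve 3 (λ s t y → (s :* t) :* (s :* y) := (s :* s) :* (t :* y)) refl (sign a) (sign b) x ⟩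
    (sign a * sign a) * (sign b * x)  ≈⟨ *-congʳ (sign-square a) ⟩
    1# * (sign b * x)                 ≈⟨ *-identityˡ _ ⟩
    sign b * x                        ∎

  sign-suc-suc : ∀ a → sign (suc (suc a)) ≈ sign a
  sign-suc-suc a = trans (sign-suc (suc a)) (trans (-‿cong (sign-suc a)) (-‿involutive _))

  sign-punchOut : ∀ {n} {i j : Fin (suc (suc n))} (i≢j : i ≢ j) (j≢i : j ≢ i) →
    sign (toℕ i ℕ.+ toℕ (punchOut i≢j)) ≈ - sign (toℕ j ℕ.+ toℕ (punchOut j≢i))
  sign-punchOut {i = zero}  {zero}  i≢j _ = ⊥-elim (i≢j ≡.refl)
  sign-punchOut {i = zero}  {suc j} _   _ = begin
    sign (toℕ j)               ≈⟨ sign-suc-suc (toℕ j) ⟨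
    sign (suc (suc (toℕ j)))   ≈⟨ sign-suc (suc (toℕ j)) ⟩
    - sign (suc (toℕ j))       ≡⟨ ≡.cong (λ x → - sign (suc x)) (ℕₚ.+-identityʳ (toℕ j)) ⟨
    - sign (suc (toℕ j ℕ.+ 0)) ∎
  sign-punchOut {i = suc i} {zero}  _   _ = begin
    sign (suc (toℕ i ℕ.+ 0))   ≡⟨ ≡.cong (sign ∘ suc) (ℕₚ.+-identityʳ (toℕ i)) ⟩
    sign (suc (toℕ i))         ≈⟨ sign-suc (toℕ i) ⟩
    - sign (toℕ i)             ∎
  sign-punchOut {suc n} {suc i} {suc j} i≢j j≢i = begin
    sign (suc (toℕ i ℕ.+ suc (toℕ (punchOut (i≢j ∘ ≡.cong suc)))))
      ≡⟨ ≡.cong (sign ∘ suc) (ℕₚ.+-suc (toℕ i) _) ⟩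
    sign (suc (suc (toℕ i ℕ.+ toℕ (punchOut (i≢j ∘ ≡.cong suc)))))
      ≈⟨ sign-suc-suc (toℕ i ℕ.+ toℕ (punchOut (i≢j ∘ ≡.cong suc))) ⟩
    sign (toℕ i ℕ.+ toℕ (punchOut (i≢j ∘ ≡.cong suc)))
      ≈⟨ sign-punchOut (i≢j ∘ ≡.cong suc) (j≢i ∘ ≡.cong suc) ⟩
    - sign (toℕ j ℕ.+ toℕ (punchOut (j≢i ∘ ≡.cong suc)))
      ≈⟨ -‿cong (sign-suc-suc (toℕ j ℕ.+ toℕ (punchOut (j≢i ∘ ≡.cong suc)))) ⟨
    - sign (suc (suc (toℕ j ℕ.+ toℕ (punchOut (j≢i ∘ ≡.cong suc)))))
      ≡⟨ ≡.cong (λ x → - sign (suc x)) (ℕₚ.+-suc (toℕ j) _) ⟨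
    - sign (suc (toℕ j ℕ.+ suc (toℕ (punchOut (j≢i ∘ ≡.cong suc))))) ∎
  sign-punchOut {zero} {suc zero} {suc zero} i≢j _ = ⊥-elim (i≢j ≡.refl)

  row≈ : ∀ {n} {u v : Fin n → Carrier} → u ≡ v → ∀ j → u j ≈ v j
  row≈ u≡v j = reflexive (≡.cong (λ u → u j) u≡v)

  Respects≈ᴹ : ∀ {n} → (Matrix n → Carrier) → Set (c ⊔ ℓ)
  Respects≈ᴹ {n} f = ∀ {A B : Matrix n} → A ≈ᴹ B → f A ≈ f B

  VanishesOnEqualRows : ∀ {n} → (Matrix n → Carrier) → Fin n → Fin n → Set (c ⊔ ℓ)
  VanishesOnEqualRows f a b = ∀ X → (∀ j → X a j ≈ X b j) → f X ≈ 0#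

  AgreeOffRow : ∀ {n} → Fin n → Matrix n → Matrix n → Set ℓ
  AgreeOffRow k X Y = ∀ i → i ≢ k → ∀ j → X i j ≈ Y i j

  RowLinear : ∀ {n} → (Matrix n → Carrier) → Set (c ⊔ ℓ)
  RowLinear {n} f = ∀ k (X U V : Matrix n) α → AgreeOffRow k X U → AgreeOffRow k X V →
    (∀ j → X k j ≈ α * U k j + V k j) → f X ≈ α * f U + f V

  Alternating : ∀ {n} → (Matrix n → Carrier) → Set (c ⊔ ℓ)
  Alternating {n} f = ∀ {a b : Fin n} → a ≢ b → VanishesOnEqualRows f a b

  record IsAlternatingMultilinear {n} (f : Matrix n → Carrier) : Set (c ⊔ ℓ) where
    field
      respects-≈ᴹ : Respects≈ᴹ f
      rowLinear   : RowLinear f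
      alternating : Alternating f

  rowAdditive : ∀ {n} {f : Matrix n → Carrier} → RowLinear f → ∀ k (X U V : Matrix n) →
    AgreeOffRow k X U → AgreeOffRow k X V → (∀ j → X k j ≈ U k j + V k j) → f X ≈ f U + f V
  rowAdditive f-linear k X U V X≈U X≈V Xₖ =
    trans (f-linear k X U V 1# X≈U X≈V (λ j → trans (Xₖ j) (+-congʳ (sym (*-identityˡ _)))))
          (+-congʳ (*-identityˡ _))

  module TwoRows {n} (X : Matrix n) {a b : Fin n} (a≢b : a ≢ b) where

    withRows : (Fin n → Carrier) → (Fin n → Carrier) → Matrix n
    withRows u v = updateAt (updateAt X a (const u)) b (const v)

    withRows-a : ∀ u v → withRows u v a ≡ u
    withRows-a u v = ≡.trans (updateAt-minimal a b _ a≢b) (updateAt-updates a X)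

    withRows-b : ∀ u v → withRows u v b ≡ v
    withRows-b u v = updateAt-updates b _

    withRows-others : ∀ u v i → i ≢ a → i ≢ b → withRows u v i ≡ X i
    withRows-others u v i i≢a i≢b = ≡.trans (updateAt-minimal i b _ i≢b) (updateAt-minimal i a X i≢a)

    withRows-agreeOff-a : ∀ u u′ v → AgreeOffRow a (withRows u v) (withRows u′ v)
    withRows-agreeOff-a u u′ v i i≢a with i ≟ b
    ... | yes ≡.refl = row≈ (≡.trans (withRows-b u v) (≡.sym (withRows-b u′ v)))
    ... | no i≢b     = row≈ (≡.trans (withRows-others u v i i≢a i≢b) (≡.sym (withRows-others u′ v i i≢a i≢b)))

    withRows-agreeOff-b : ∀ u v v′ → AgreeOffRow b (withRows u v) (withRows u v′)
    withRows-agreeOff-b u v v′ i i≢b = row≈ (≡.trans (updateAt-minimal i b _ i≢b) (≡.sym (updateAt-minimal i b _ i≢b)))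

    X≈withRows : X ≈ᴹ withRows (X a) (X b)
    X≈withRows i = row≈ (≗-byCases a b (≡.sym (withRows-a (X a) (X b))) (≡.sym (withRows-b (X a) (X b)))
      (λ i i≢a i≢b → ≡.sym (withRows-others (X a) (X b) i i≢a i≢b)) i)

    X∘transpose≈withRows : X ∘ transpose a b ≈ᴹ withRows (X b) (X a)
    X∘transpose≈withRows i = row≈ (≗-byCases a b
      (≡.trans (≡.cong X (transpose-matchˡ a b)) (≡.sym (withRows-a (X b) (X a))))
      (≡.trans (≡.cong X (transpose-matchʳ a b)) (≡.sym (withRows-b (X b) (X a))))
      (λ i i≢a i≢b → ≡.trans (≡.cong X (transpose-others i≢a i≢b)) (≡.sym (withRows-others (X b) (X a) i i≢a i≢b))) i)

  -- Expand f on the matrix whose rows a and b both equal X a + X b.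
  swapRows-antisymmetric : ∀ {n} {f : Matrix n → Carrier} → Respects≈ᴹ f → RowLinear f →
    ∀ {a b} → a ≢ b → VanishesOnEqualRows f a b → ∀ X → f (X ∘ transpose a b) ≈ - f X
  swapRows-antisymmetric {n} {f} f-cong f-linear {a} {b} a≢b f-alt X = +-inverseˡ-unique _ _ (begin
    f (X ∘ transpose a b) + f X                      ≈⟨ +-cong (f-cong X∘transpose≈withRows) (f-cong X≈withRows) ⟩
    f (R xb xa) + f (R xa xb)                        ≈⟨ +-cong (+-identityʳ _) (+-identityˡ _) ⟨
    (f (R xb xa) + 0#) + (0# + f (R xa xb))          ≈⟨ +-cong (+-congˡ (equal xb)) (+-congʳ (equal xa)) ⟨
    (f (R xb xa) + f (R xb xb)) + (f (R xa xa) + f (R xa xb))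
      ≈⟨ +-cong (additive-b xb xa xb) (additive-b xa xa xb) ⟨
    f (R xb s) + f (R xa s)                          ≈⟨ +-comm _ _ ⟩
    f (R xa s) + f (R xb s)                          ≈⟨ additive-a xa xb s ⟨
    f (R s s)                                        ≈⟨ equal s ⟩
    0#                                               ∎)
    where
    open TwoRows X a≢b renaming (withRows to R)
    xa = X a
    xb = X b
    s : Fin n → Carrier
    s j = xa j + xb j
    equal : ∀ u → f (R u u) ≈ 0#
    equal u = f-alt (R u u) (row≈ (≡.trans (withRows-a u u) (≡.sym (withRows-b u u))))
    additive-a : ∀ u u′ v → f (R (λ j → u j + u′ j) v) ≈ f (R u v) + f (R u′ v)
    additive-a u u′ v = rowAdditive f-linear a _ _ _ (withRows-agreeOff-a _ u v) (withRows-agreeOff-a _ u′ v)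
      (λ j → trans (row≈ (withRows-a _ v) j) (sym (+-cong (row≈ (withRows-a u v) j) (row≈ (withRows-a u′ v) j))))
    additive-b : ∀ u v v′ → f (R u (λ j → v j + v′ j)) ≈ f (R u v) + f (R u v′)
    additive-b u v v′ = rowAdditive f-linear b _ _ _ (withRows-agreeOff-b u _ v) (withRows-agreeOff-b u _ v′)
      (λ j → trans (row≈ (withRows-b u _) j) (sym (+-cong (row≈ (withRows-b u v) j) (row≈ (withRows-b u v′) j))))

  det-cong : ∀ n {A B : Matrix n} → A ≈ᴹ B → det K n A ≈ det K n B
  det-cong zero    A≈B = refl
  det-cong (suc n) {A} {B} A≈B = begin
    det K (suc n) A    ≡⟨ det-expand n A ⟩
    ∑ (laplaceTerm A)  ≈⟨ ∑-cong (λ j → *-cong refl (*-cong (A≈B zero j) (det-cong n (λ r s → A≈B (suc r) (punchIn j s))))) ⟩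
    ∑ (laplaceTerm B)  ≡⟨ det-expand n B ⟨
    det K (suc n) B    ∎

  det-rowLinear : ∀ n → RowLinear (det K n)
  det-rowLinear (suc n) k X U V α X≈U X≈V Xₖ = begin
    det K (suc n) X                            ≡⟨ det-expand n X ⟩
    ∑ (laplaceTerm X)                          ≈⟨ ∑-linear α (term k X≈U X≈V Xₖ) ⟩
    α * ∑ (laplaceTerm U) + ∑ (laplaceTerm V)  ≡⟨ ≡.cong₂ (λ u v → α * u + v) (det-expand n U) (det-expand n V) ⟨
    α * det K (suc n) U + det K (suc n) V      ∎
    where
    linearʳ : ∀ s x u v d → s * ((x * u + v) * d) ≈ x * (s * (u * d)) + s * (v * d)
    linearʳ = solve 5 (λ s x u v d → s :* ((x :* u :+ v) :* d) := x :* (s :* (u :* d)) :+ s :* (v :* d)) refl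
    linearˡ : ∀ s x u a b → s * (u * (x * a + b)) ≈ x * (s * (u * a)) + s * (u * b)
    linearˡ = solve 5 (λ s x u a b → s :* (u :* (x :* a :+ b)) := x :* (s :* (u :* a)) :+ s :* (u :* b)) refl
    term : ∀ k → AgreeOffRow k X U → AgreeOffRow k X V → (∀ j → X k j ≈ α * U k j + V k j) →
      ∀ j → laplaceTerm X j ≈ α * laplaceTerm U j + laplaceTerm V j
    term zero X≈U X≈V Xₖ j = begin
      s * (X zero j * det K n (minor X j))                ≈⟨ *-congˡ (*-congʳ (Xₖ j)) ⟩
      s * ((α * U zero j + V zero j) * det K n (minor X j)) ≈⟨ linearʳ _ _ _ _ _ ⟩
      α * (s * (U zero j * det K n (minor X j))) + s * (V zero j * det K n (minor X j))
        ≈⟨ +-cong (*-congˡ (*-congˡ (*-congˡ (minor≈ X≈U)))) (*-congˡ (*-congˡ (minor≈ X≈V))) ⟩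
      α * laplaceTerm U j + laplaceTerm V j                ∎
      where
      s = sign (toℕ j)
      minor≈ : ∀ {Y} → AgreeOffRow zero X Y → det K n (minor X j) ≈ det K n (minor Y j)
      minor≈ X≈Y = det-cong n (λ r t → X≈Y (suc r) (λ ()) (punchIn j t))
    term (suc k) X≈U X≈V Xₖ j = begin
      s * (X zero j * det K n (minor X j))
        ≈⟨ *-congˡ (*-congˡ (det-rowLinear n k (minor X j) (minor U j) (minor V j) α
             (λ r r≢k t → X≈U (suc r) (r≢k ∘ suc-injective) _)
             (λ r r≢k t → X≈V (suc r) (r≢k ∘ suc-injective) _)
             (λ t → Xₖ (punchIn j t)))) ⟩
      s * (X zero j * (α * det K n (minor U j) + det K n (minor V j))) ≈⟨ linearˡ _ _ _ _ _ ⟩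
      α * (s * (X zero j * det K n (minor U j))) + s * (X zero j * det K n (minor V j))
        ≈⟨ +-cong (*-congˡ (*-congˡ (*-congʳ (X≈U zero (λ ()) j)))) (*-congˡ (*-congʳ (X≈V zero (λ ()) j))) ⟩
      α * laplaceTerm U j + laplaceTerm V j                ∎
      where
      s = sign (toℕ j)

  ∑-offDiagonal≈0 : ∀ m (F : Fin (suc m) → Fin (suc m) → Carrier) →
    (∀ j j′ → j ≢ j′ → F j j′ + F j′ j ≈ 0#) → ∑ (λ j → ∑ (F j ∘ punchIn j)) ≈ 0#
  ∑-offDiagonal≈0 zero    F anti = ∑-zero (λ j → ∑-zero (λ ()))
  ∑-offDiagonal≈0 (suc m) F anti = begin
    ∑ (λ j → ∑ (F j ∘ punchIn j))
      ≡⟨ ∑-suc _ ⟩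
    ∑ (F zero ∘ suc) + ∑ (λ j → ∑ (F (suc j) ∘ punchIn (suc j)))
      ≈⟨ +-congˡ (∑-cong (λ j → reflexive (∑-suc _))) ⟩
    ∑ (F zero ∘ suc) + ∑ (λ j → F (suc j) zero + ∑ (F (suc j) ∘ suc ∘ punchIn j))
      ≈⟨ +-congˡ (∑-+ _ _) ⟩
    ∑ (F zero ∘ suc) + (∑ (λ j → F (suc j) zero) + rest)
      ≈⟨ +-assoc _ _ _ ⟨
    (∑ (F zero ∘ suc) + ∑ (λ j → F (suc j) zero)) + rest
      ≈⟨ +-cong (sym (∑-+ _ _)) (∑-offDiagonal≈0 m (λ j j′ → F (suc j) (suc j′)) (λ j j′ j≢j′ → anti _ _ (j≢j′ ∘ suc-injective))) ⟩
    ∑ (λ s → F zero (suc s) + F (suc s) zero) + 0#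
      ≈⟨ +-identityʳ _ ⟩
    ∑ (λ s → F zero (suc s) + F (suc s) zero)
      ≈⟨ ∑-zero (λ s → anti zero (suc s) (λ ())) ⟩
    0# ∎
    where
    rest = ∑ (λ j → ∑ (F (suc j) ∘ suc ∘ punchIn j))

  -- Expanding along the first two rows pairs the term of columns (j, j′) with that of (j′, j).
  module EqualFirstRows {m} (X : Matrix (suc (suc m))) (X₀≈X₁ : ∀ j → X zero j ≈ X (suc zero) j) where

    minor₂ : Fin (suc (suc m)) → Fin (suc m) → Matrix m
    minor₂ j = minor (minor X j)

    G : Fin (suc (suc m)) → Fin (suc m) → Carrier
    G j s = sign (toℕ j) * (X zero j * laplaceTerm (minor X j) s)

    expandMinor : ∀ j → laplaceTerm X j ≈ ∑ (G j)
    expandMinor j = begin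
      sign (toℕ j) * (X zero j * det K (suc m) (minor X j))
        ≡⟨ ≡.cong (λ d → sign (toℕ j) * (X zero j * d)) (det-expand m (minor X j)) ⟩
      sign (toℕ j) * (X zero j * ∑ (laplaceTerm (minor X j)))
        ≈⟨ *-congˡ (*-distribˡ-∑ _ _) ⟩
      sign (toℕ j) * ∑ (λ s → X zero j * laplaceTerm (minor X j) s)
        ≈⟨ *-distribˡ-∑ _ _ ⟩
      ∑ (G j) ∎

    H : ∀ {j j′} → j ≢ j′ → Carrier
    H {j} {j′} j≢j′ =
      sign (toℕ j ℕ.+ toℕ (punchOut j≢j′)) * ((X zero j * X zero j′) * det K m (minor₂ j (punchOut j≢j′)))

    F : Fin (suc (suc m)) → Fin (suc (suc m)) → Carrier
    F j j′ with j ≟ j′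
    ... | yes _    = 0#
    ... | no j≢j′ = G j (punchOut j≢j′)

    G≈H : ∀ {j j′} (j≢j′ : j ≢ j′) → G j (punchOut j≢j′) ≈ H j≢j′
    G≈H {j} {j′} j≢j′ = begin
      sign (toℕ j) * (X zero j * (sign (toℕ p) * (X (suc zero) (punchIn j p) * d)))
        ≈⟨ *-congˡ (*-congˡ (*-congˡ (*-congʳ X₁ₚ≈X₀j′))) ⟩
      sign (toℕ j) * (X zero j * (sign (toℕ p) * (X zero j′ * d)))
        ≈⟨ rearrange _ _ _ _ _ ⟩
      (sign (toℕ j) * sign (toℕ p)) * ((X zero j * X zero j′) * d)
        ≈⟨ *-congʳ (sign-+ (toℕ j) (toℕ p)) ⟨
      H j≢j′ ∎
      where
      p = punchOut j≢j′
      d = det K m (minor₂ j p)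
      X₁ₚ≈X₀j′ : X (suc zero) (punchIn j p) ≈ X zero j′
      X₁ₚ≈X₀j′ = trans (reflexive (≡.cong (X (suc zero)) (punchIn-punchOut j≢j′))) (sym (X₀≈X₁ j′))
      rearrange : ∀ a b x y e → a * (x * (b * (y * e))) ≈ (a * b) * ((x * y) * e)
      rearrange = solve 5 (λ a b x y e → a :* (x :* (b :* (y :* e))) := (a :* b) :* ((x :* y) :* e)) refl

    F≈H : ∀ {j j′} (j≢j′ : j ≢ j′) → F j j′ ≈ H j≢j′
    F≈H {j} {j′} j≢j′ with j ≟ j′
    ... | yes j≡j′ = ⊥-elim (j≢j′ j≡j′)
    ... | no j≢j′₂ = trans (G≈H j≢j′₂)
      (reflexive (≡.cong (λ p → sign (toℕ j ℕ.+ toℕ p) * ((X zero j * X zero j′) * det K m (minor₂ j p)))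
                         (punchOut-cong j ≡.refl)))

    G≈F : ∀ j s → G j s ≈ F j (punchIn j s)
    G≈F j s = begin
      G j s          ≡⟨ ≡.cong (G j) (punchOut-punchIn j) ⟨
      G j (punchOut j≢pᵢs)  ≈⟨ G≈H j≢pᵢs ⟩
      H j≢pᵢs        ≈⟨ F≈H j≢pᵢs ⟨
      F j (punchIn j s) ∎
      where
      j≢pᵢs : j ≢ punchIn j s
      j≢pᵢs = punchInᵢ≢i j s ∘ ≡.sym

    F-antisymmetric : ∀ j j′ → j ≢ j′ → F j j′ + F j′ j ≈ 0#
    F-antisymmetric j j′ j≢j′ = begin
      F j j′ + F j′ j                               ≈⟨ +-cong (F≈H j≢j′) (F≈H j′≢j) ⟩
      H j≢j′ + H j′≢j
        ≈⟨ +-congʳ (*-cong (sign-punchOut j≢j′ j′≢j) (*-cong (*-comm _ _) (det-cong m sameMinor))) ⟩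
      - sign (toℕ j′ ℕ.+ toℕ (punchOut j′≢j)) * Q + H j′≢j  ≈⟨ +-congʳ (-‿distribˡ-* _ _) ⟨
      - H j′≢j + H j′≢j                             ≈⟨ -‿inverseˡ _ ⟩
      0#                                            ∎
      where
      j′≢j : j′ ≢ j
      j′≢j = j≢j′ ∘ ≡.sym
      Q = (X zero j′ * X zero j) * det K m (minor₂ j′ (punchOut j′≢j))
      sameMinor : minor₂ j (punchOut j≢j′) ≈ᴹ minor₂ j′ (punchOut j′≢j)
      sameMinor r t = reflexive (≡.cong (X (suc (suc r))) (punchIn-punchOut-comm j≢j′ j′≢j t))

  det-equalFirstRows≈0 : ∀ m (X : Matrix (suc (suc m))) →
    (∀ j → X zero j ≈ X (suc zero) j) → det K (suc (suc m)) X ≈ 0#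
  det-equalFirstRows≈0 m X X₀≈X₁ = begin
    det K (suc (suc m)) X              ≡⟨ det-expand (suc m) X ⟩
    ∑ (laplaceTerm X)                  ≈⟨ ∑-cong expandMinor ⟩
    ∑ (λ j → ∑ (G j))                  ≈⟨ ∑-cong (λ j → ∑-cong (G≈F j)) ⟩
    ∑ (λ j → ∑ (F j ∘ punchIn j))      ≈⟨ ∑-offDiagonal≈0 (suc m) F F-antisymmetric ⟩
    0#                                 ∎
    where open EqualFirstRows X X₀≈X₁

  det-swapFirstRows : ∀ m (X : Matrix (suc (suc m))) →
    det K (suc (suc m)) (X ∘ transpose zero (suc zero)) ≈ - det K (suc (suc m)) X
  det-swapFirstRows m = swapRows-antisymmetric (det-cong _) (det-rowLinear _) (λ ()) (det-equalFirstRows≈0 m)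

  det-alternating : ∀ n → Alternating (det K n)

  det-vanishesOnEqualRowsBelow : ∀ n {a b : Fin n} → a ≢ b → VanishesOnEqualRows (det K (suc n)) (suc a) (suc b)
  det-vanishesOnEqualRowsBelow n a≢b X Xa≈Xb = trans (reflexive (det-expand n X)) (∑-zero λ j →
    trans (*-congˡ (trans (*-congˡ (det-alternating n a≢b (minor X j) (Xa≈Xb ∘ punchIn j))) (zeroʳ _))) (zeroʳ _))

  det-vanishesOnEqualRowsFirst : ∀ m b → VanishesOnEqualRows (det K (suc (suc m))) zero (suc b)
  det-vanishesOnEqualRowsFirst m zero    = det-equalFirstRows≈0 m
  det-vanishesOnEqualRowsFirst m (suc b) X X₀≈X = begin
    det K (suc (suc m)) X                                 ≈⟨ -‿involutive _ ⟨
    - - det K (suc (suc m)) X                             ≈⟨ -‿cong (det-swapFirstRows m X) ⟨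
    - det K (suc (suc m)) (X ∘ transpose zero (suc zero))
      ≈⟨ -‿cong (det-vanishesOnEqualRowsBelow (suc m) {zero} {suc b} (λ ()) (X ∘ transpose zero (suc zero)) X₀≈X) ⟩
    - 0#                                                  ≈⟨ -0#≈0# ⟩
    0#                                                    ∎

  det-alternating (suc n)       {zero}  {zero}  0≢0 = λ _ _ → ⊥-elim (0≢0 ≡.refl)
  det-alternating (suc n)       {suc a} {suc b} a≢b = det-vanishesOnEqualRowsBelow n (a≢b ∘ ≡.cong suc)
  det-alternating (suc (suc m)) {zero}  {suc b} _   = det-vanishesOnEqualRowsFirst m b
  det-alternating (suc (suc m)) {suc a} {zero}  _   = λ X Xa≈X₀ → det-vanishesOnEqualRowsFirst m a X (sym ∘ Xa≈X₀)

  det-swapRows : ∀ n {a b : Fin n} → a ≢ b → ∀ X → det K n (X ∘ transpose a b) ≈ - det K n X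
  det-swapRows n a≢b = swapRows-antisymmetric (det-cong n) (det-rowLinear n) a≢b (det-alternating n a≢b)

  1ᴹ : ∀ {n} → Matrix n
  1ᴹ i j with i ≟ j
  ... | yes _ = 1#
  ... | no _  = 0#

  1ᴹ-diagonal : ∀ {n} (i : Fin n) → 1ᴹ i i ≈ 1#
  1ᴹ-diagonal i with i ≟ i
  ... | yes _   = refl
  ... | no i≢i = ⊥-elim (i≢i ≡.refl)

  1ᴹ-offDiagonal : ∀ {n} {i j : Fin n} → i ≢ j → 1ᴹ i j ≈ 0#
  1ᴹ-offDiagonal {i = i} {j} i≢j with i ≟ j
  ... | yes i≡j = ⊥-elim (i≢j i≡j)
  ... | no _    = refl

  1ᴹ-reindex : ∀ {m n} {σ : Fin m → Fin n} → Injective _≡_ _≡_ σ → ∀ i j → 1ᴹ (σ i) (σ j) ≈ 1ᴹ i j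
  1ᴹ-reindex {σ = σ} σ-injective i j with σ i ≟ σ j | i ≟ j
  ... | yes _       | yes _    = refl
  ... | no _        | no _     = refl
  ... | yes σi≡σj   | no i≢j   = ⊥-elim (i≢j (σ-injective σi≡σj))
  ... | no σi≢σj    | yes i≡j  = ⊥-elim (σi≢σj (≡.cong σ i≡j))

  infixl 7 _*ᴹ_
  _*ᴹ_ : ∀ {n} → Matrix n → Matrix n → Matrix n
  (X *ᴹ Y) i j = ∑ (λ k → X i k * Y k j)

  *ᴹ-identityˡ : ∀ {n} (Y : Matrix n) → 1ᴹ *ᴹ Y ≈ᴹ Y
  *ᴹ-identityˡ {suc n} Y i j = begin
    ∑ (λ k → 1ᴹ i k * Y k j) ≈⟨ ∑-delta i (λ k k≢i → trans (*-congʳ (1ᴹ-offDiagonal (k≢i ∘ ≡.sym))) (zeroˡ _)) ⟩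
    1ᴹ i i * Y i j           ≈⟨ *-congʳ (1ᴹ-diagonal i) ⟩
    1# * Y i j               ≈⟨ *-identityˡ _ ⟩
    Y i j                    ∎

  *ᴹ-identityʳ : ∀ {n} (X : Matrix n) → X *ᴹ 1ᴹ ≈ᴹ X
  *ᴹ-identityʳ {suc n} X i j = begin
    ∑ (λ k → X i k * 1ᴹ k j) ≈⟨ ∑-delta j (λ k k≢j → trans (*-congˡ (1ᴹ-offDiagonal k≢j)) (zeroʳ _)) ⟩
    X i j * 1ᴹ j j           ≈⟨ *-congˡ (1ᴹ-diagonal j) ⟩
    X i j * 1#               ≈⟨ *-identityʳ _ ⟩
    X i j                    ∎

  insertAt-cong : ∀ {m} {u v : Fin m → Carrier} (j : Fin (suc m)) x → (∀ t → u t ≈ v t) →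
    ∀ k → insertAt u j x k ≈ insertAt v j x k
  insertAt-cong {u = u} {v} j x u≈v k with punchInView j k
  ... | at rewrite insertAt-lookup u j x | insertAt-lookup v j x = refl
  ... | punched t rewrite insertAt-punchIn u j x t | insertAt-punchIn v j x t = u≈v t

  insertAt-linear : ∀ {m} α {u v w : Fin m → Carrier} (j : Fin (suc m)) → (∀ t → u t ≈ α * v t + w t) →
    ∀ k → insertAt u j 0# k ≈ α * insertAt v j 0# k + insertAt w j 0# k
  insertAt-linear α {u} {v} {w} j u≈αv+w k with punchInView j k
  ... | at rewrite insertAt-lookup u j 0# | insertAt-lookup v j 0# | insertAt-lookup w j 0# =
    sym (trans (+-identityʳ _) (zeroʳ α))
  ... | punched t rewrite insertAt-punchIn u j 0# t | insertAt-punchIn v j 0# t | insertAt-punchIn w j 0# t =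
    u≈αv+w t

  insertAt-1ᴹ : ∀ {m} (j : Fin (suc m)) (r : Fin m) k → insertAt (1ᴹ r) j 0# k ≈ 1ᴹ (punchIn j r) k
  insertAt-1ᴹ j r k with punchInView j k
  ... | at rewrite insertAt-lookup (1ᴹ r) j 0# = sym (1ᴹ-offDiagonal (punchInᵢ≢i j r))
  ... | punched t rewrite insertAt-punchIn (1ᴹ r) j 0# t = sym (1ᴹ-reindex (Finₚ.punchIn-injective j _ _) r t)

  border : ∀ {m} → Fin (suc m) → Matrix m → Matrix (suc m)
  border j W zero    = 1ᴹ j
  border j W (suc r) = insertAt (W r) j 0#

  border-zero-1ᴹ : ∀ {m} → border {m} zero 1ᴹ ≈ᴹ 1ᴹ
  border-zero-1ᴹ zero    k = refl
  border-zero-1ᴹ (suc r) k = insertAt-1ᴹ zero r k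

  border-suc-1ᴹ : ∀ {m} (j : Fin (suc m)) →
    border (suc j) 1ᴹ ∘ transpose zero (suc zero) ≈ᴹ border zero (border j 1ᴹ)
  border-suc-1ᴹ j zero             k = insertAt-1ᴹ (suc j) zero k
  border-suc-1ᴹ j (suc zero)       k = sym (insertAt-1ᴹ zero j k)
  border-suc-1ᴹ j (suc (suc r))    k = begin
    insertAt (1ᴹ (suc r)) (suc j) 0# k              ≈⟨ insertAt-1ᴹ (suc j) (suc r) k ⟩
    1ᴹ (suc (punchIn j r)) k                        ≈⟨ insertAt-1ᴹ zero (punchIn j r) k ⟨
    insertAt (1ᴹ (punchIn j r)) zero 0# k           ≈⟨ insertAt-cong zero 0# (λ t → insertAt-1ᴹ j r t) k ⟨
    insertAt (insertAt (1ᴹ r) j 0#) zero 0# k       ∎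

  module AlternatingMultilinear {n} {f : Matrix n → Carrier} (isAM : IsAlternatingMultilinear f) where
    open IsAlternatingMultilinear isAM public

    swapRows : ∀ {a b} → a ≢ b → ∀ X → f (X ∘ transpose a b) ≈ - f X
    swapRows a≢b = swapRows-antisymmetric respects-≈ᴹ rowLinear a≢b (alternating a≢b)

    zeroRow : ∀ k X → (∀ j → X k j ≈ 0#) → f X ≈ 0#
    zeroRow k X Xₖ≈0 = begin
      f X               ≈⟨ rowLinear k X X X (- 1#) (λ _ _ _ → refl) (λ _ _ _ → refl) Xₖ≈-Xₖ+Xₖ ⟩
      - 1# * f X + f X  ≈⟨ +-congʳ (-1*x≈-x _) ⟩
      - f X + f X       ≈⟨ -‿inverseˡ _ ⟩
      0#                ∎
      where
      Xₖ≈-Xₖ+Xₖ : ∀ j → X k j ≈ - 1# * X k j + X k j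
      Xₖ≈-Xₖ+Xₖ j = trans (Xₖ≈0 j) (sym (trans (+-cong (*-congˡ (Xₖ≈0 j)) (Xₖ≈0 j)) (trans (+-identityʳ _) (zeroʳ _))))

    expandRow : ∀ {N} k X (α : Fin N → Carrier) (Z : Fin N → Matrix n) →
      (∀ t → AgreeOffRow k X (Z t)) → (∀ j → X k j ≈ ∑ (λ t → α t * Z t k j)) →
      f X ≈ ∑ (λ t → α t * f (Z t))
    expandRow {zero}  k X α Z X≈Z Xₖ =
      trans (zeroRow k X (λ j → trans (Xₖ j) (∑-zero (λ ())))) (sym (∑-zero (λ ())))
    expandRow {suc N} k X α Z X≈Z Xₖ = begin
      f X                                             ≈⟨ rowLinear k X (Z zero) X′ (α zero) (X≈Z zero) X≈X′ Xₖ≈ ⟩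
      α zero * f (Z zero) + f X′                      ≈⟨ +-congˡ (expandRow k X′ (α ∘ suc) (Z ∘ suc) X′≈Z X′ₖ) ⟩
      α zero * f (Z zero) + ∑ (λ t → α (suc t) * f (Z (suc t))) ≡⟨ ∑-suc _ ⟨
      ∑ (λ t → α t * f (Z t))                         ∎
      where
      rest : Fin n → Carrier
      rest j = ∑ (λ t → α (suc t) * Z (suc t) k j)
      X′ : Matrix n
      X′ = updateAt X k (const rest)
      X′ₖ : ∀ j → X′ k j ≈ rest j
      X′ₖ = row≈ (updateAt-updates k X)
      X≈X′ : AgreeOffRow k X X′
      X≈X′ i i≢k = row≈ (≡.sym (updateAt-minimal i k X i≢k))
      X′≈Z : ∀ t → AgreeOffRow k X′ (Z (suc t))
      X′≈Z t i i≢k j = trans (sym (X≈X′ i i≢k j)) (X≈Z (suc t) i i≢k j)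
      Xₖ≈ : ∀ j → X k j ≈ α zero * Z zero k j + X′ k j
      Xₖ≈ j = trans (Xₖ j) (trans (reflexive (∑-suc _)) (+-congˡ (sym (X′ₖ j))))

    addRowMultiple : ∀ {a b} → a ≢ b → ∀ α X Y → AgreeOffRow b Y X →
      (∀ j → Y b j ≈ X b j + α * X a j) → f Y ≈ f X
    addRowMultiple {a} {b} a≢b α X Y Y≈X Y≈X+αXa = begin
      f Y               ≈⟨ rowLinear b Y U X α Y≈U Y≈X Yb≈ ⟩
      α * f U + f X     ≈⟨ +-congʳ (trans (*-congˡ (alternating a≢b U Ua≈Ub)) (zeroʳ α)) ⟩
      0# + f X          ≈⟨ +-identityˡ _ ⟩
      f X               ∎
      where
      U : Matrix n
      U = updateAt X b (const (X a))
      Y≈U : AgreeOffRow b Y U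
      Y≈U i i≢b j = trans (Y≈X i i≢b j) (row≈ (≡.sym (updateAt-minimal i b X i≢b)) j)
      Ua≈Ub : ∀ j → U a j ≈ U b j
      Ua≈Ub = row≈ (≡.trans (updateAt-minimal a b X a≢b) (≡.sym (updateAt-updates b X)))
      Yb≈ : ∀ j → Y b j ≈ α * U b j + X b j
      Yb≈ j = trans (Y≈X+αXa j) (trans (+-comm _ _) (+-congʳ (*-congˡ (row≈ (≡.sym (updateAt-updates b X)) j))))

  module _ {m} {f : Matrix (suc m) → Carrier} (isAM : IsAlternatingMultilinear f) where
    open AlternatingMultilinear isAM

    module AddFirstRowMultiples (α : Fin m → Carrier) (X Y : Matrix (suc m)) (Y₀≈X₀ : ∀ j → Y zero j ≈ X zero j)
      (Y≈X+αX₀ : ∀ r j → Y (suc r) j ≈ X (suc r) j + α r * X zero j) where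

      partial : ℕ → Matrix (suc m)
      partial t zero = X zero
      partial t (suc r) with toℕ r ℕ.<? t
      ... | yes _ = Y (suc r)
      ... | no _  = X (suc r)

      partial-below : ∀ {t r} → toℕ r ℕ.< t → partial t (suc r) ≡ Y (suc r)
      partial-below {t} {r} r<t with toℕ r ℕ.<? t
      ... | yes _  = ≡.refl
      ... | no r≮t = ⊥-elim (r≮t r<t)

      partial-above : ∀ {t r} → ¬ toℕ r ℕ.< t → partial t (suc r) ≡ X (suc r)
      partial-above {t} {r} r≮t with toℕ r ℕ.<? t
      ... | yes r<t = ⊥-elim (r≮t r<t)
      ... | no _    = ≡.refl

      partial-all : Y ≈ᴹ partial m
      partial-all zero    = Y₀≈X₀
      partial-all (suc r) = row≈ (≡.sym (partial-below (Finₚ.toℕ<n r)))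

      partial-none : partial 0 ≈ᴹ X
      partial-none zero    j = refl
      partial-none (suc r) = row≈ (partial-above {0} λ ())

      partial-beyond : ∀ {t} → ¬ t ℕ.< m → partial (suc t) ≈ᴹ partial t
      partial-beyond t≮m zero    j = refl
      partial-beyond t≮m (suc r) = row≈ (≡.trans (partial-below (ℕₚ.m<n⇒m<1+n r<t)) (≡.sym (partial-below r<t)))
        where r<t = ℕₚ.<-≤-trans (Finₚ.toℕ<n r) (ℕₚ.≮⇒≥ t≮m)

      module Step {t} (t<m : t ℕ.< m) where

        r₀ : Fin m
        r₀ = fromℕ< t<m

        r₀≡t : toℕ r₀ ≡ t
        r₀≡t = Finₚ.toℕ-fromℕ< t<m

        sameRow : ∀ r → r ≢ r₀ → Dec (toℕ r ℕ.< t) → partial (suc t) (suc r) ≡ partial t (suc r)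
        sameRow r _    (yes r<t) = ≡.trans (partial-below (ℕₚ.m<n⇒m<1+n r<t)) (≡.sym (partial-below r<t))
        sameRow r r≢r₀ (no r≮t)  = ≡.trans (partial-above r≮1+t) (≡.sym (partial-above r≮t))
          where
          r≮1+t : ¬ toℕ r ℕ.< suc t
          r≮1+t r<1+t = r≢r₀ (Finₚ.toℕ-injective
            (≡.trans (ℕₚ.≤-antisym (ℕₚ.≤-pred r<1+t) (ℕₚ.≮⇒≥ r≮t)) (≡.sym r₀≡t)))

        sameElsewhere : AgreeOffRow (suc r₀) (partial (suc t)) (partial t)
        sameElsewhere zero    _    j = refl
        sameElsewhere (suc r) r≢r₀ = row≈ (sameRow r (r≢r₀ ∘ ≡.cong suc) (toℕ r ℕ.<? t))

        changedRow : ∀ j → partial (suc t) (suc r₀) j ≈ partial t (suc r₀) j + α r₀ * partial t zero j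
        changedRow j = begin
          partial (suc t) (suc r₀) j          ≡⟨ ≡.cong (λ u → u j) (partial-below (ℕₚ.≤-reflexive (≡.cong suc r₀≡t))) ⟩
          Y (suc r₀) j                        ≈⟨ Y≈X+αX₀ r₀ j ⟩
          X (suc r₀) j + α r₀ * X zero j      ≡⟨ ≡.cong (λ u → u j + α r₀ * X zero j) (partial-above (ℕₚ.<-irrefl r₀≡t)) ⟨
          partial t (suc r₀) j + α r₀ * partial t zero j ∎

      partial-step : ∀ t → f (partial (suc t)) ≈ f (partial t)
      partial-step t with t ℕ.<? m
      ... | no t≮m  = respects-≈ᴹ (partial-beyond t≮m)
      ... | yes t<m = addRowMultiple {zero} {suc r₀} (λ ()) (α r₀) (partial t) (partial (suc t)) sameElsewhere changedRow
        where open Step t<m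

      partial-steps : ∀ t → f (partial t) ≈ f (partial 0)
      partial-steps zero    = refl
      partial-steps (suc t) = trans (partial-step t) (partial-steps t)

    addFirstRowMultiples : ∀ (α : Fin m → Carrier) X Y → (∀ j → Y zero j ≈ X zero j) →
      (∀ r j → Y (suc r) j ≈ X (suc r) j + α r * X zero j) → f Y ≈ f X
    addFirstRowMultiples α X Y Y₀≈X₀ Y≈X+αX₀ = begin
      f Y              ≈⟨ respects-≈ᴹ partial-all ⟩
      f (partial m)    ≈⟨ partial-steps m ⟩
      f (partial 0)    ≈⟨ respects-≈ᴹ partial-none ⟩
      f X              ∎
      where open AddFirstRowMultiples α X Y Y₀≈X₀ Y≈X+αX₀

    clearColumn : ∀ j X → (∀ k → X zero k ≈ 1ᴹ j k) → f X ≈ f (border j (minor X j))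
    clearColumn j X X₀≈1ᴹⱼ = sym (addFirstRowMultiples (λ r → - X (suc r) j) X (border j (minor X j)) (sym ∘ X₀≈1ᴹⱼ) cleared)
      where
      cleared : ∀ r k → insertAt (minor X j r) j 0# k ≈ X (suc r) k + - X (suc r) j * X zero k
      cleared r k with punchInView j k
      ... | at rewrite insertAt-lookup (minor X j r) j 0# = sym (begin
        X (suc r) j + - X (suc r) j * X zero j ≈⟨ +-congˡ (*-congˡ (trans (X₀≈1ᴹⱼ j) (1ᴹ-diagonal j))) ⟩
        X (suc r) j + - X (suc r) j * 1#       ≈⟨ +-congˡ (*-identityʳ _) ⟩
        X (suc r) j + - X (suc r) j            ≈⟨ -‿inverseʳ _ ⟩
        0#                                     ∎)
      ... | punched t rewrite insertAt-punchIn (minor X j r) j 0# t = sym (begin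
        X (suc r) (punchIn j t) + - X (suc r) j * X zero (punchIn j t)
          ≈⟨ +-congˡ (*-congˡ (trans (X₀≈1ᴹⱼ _) (1ᴹ-offDiagonal (punchInᵢ≢i j t ∘ ≡.sym)))) ⟩
        X (suc r) (punchIn j t) + - X (suc r) j * 0#
          ≈⟨ +-congˡ (zeroʳ _) ⟩
        X (suc r) (punchIn j t) + 0#
          ≈⟨ +-identityʳ _ ⟩
        X (suc r) (punchIn j t) ∎)

  border-isAlternatingMultilinear : ∀ {m} {f : Matrix (suc m) → Carrier} → IsAlternatingMultilinear f →
    ∀ j → IsAlternatingMultilinear (f ∘ border j)
  border-isAlternatingMultilinear isAM j = record
    { respects-≈ᴹ = λ A≈B → respects-≈ᴹ (border-cong A≈B)
    ; rowLinear   = λ k X U V α X≈U X≈V Xₖ → rowLinear (suc k) _ _ _ α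
        (border-agreeOffRow X≈U) (border-agreeOffRow X≈V) (insertAt-linear α j Xₖ)
    ; alternating = λ a≢b W Wa≈Wb → alternating (a≢b ∘ suc-injective) (border j W) (insertAt-cong j 0# Wa≈Wb)
    }
    where
    open IsAlternatingMultilinear isAM
    border-cong : ∀ {A B} → A ≈ᴹ B → border j A ≈ᴹ border j B
    border-cong A≈B zero    k = refl
    border-cong A≈B (suc r) k = insertAt-cong j 0# (A≈B r) k
    border-agreeOffRow : ∀ {k X U} → AgreeOffRow k X U → AgreeOffRow (suc k) (border j X) (border j U)
    border-agreeOffRow X≈U zero    _   col = refl
    border-agreeOffRow X≈U (suc i) i≢k col = insertAt-cong j 0# (X≈U i (i≢k ∘ ≡.cong suc)) col

  -- border j 1ᴹ is the permutation matrix of the cycle (0 1 … j).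
  border-1ᴹ-sign : ∀ {m} {f : Matrix (suc m) → Carrier} → IsAlternatingMultilinear f →
    ∀ j → f (border j 1ᴹ) ≈ sign (toℕ j) * f 1ᴹ
  border-1ᴹ-sign isAM zero = trans (respects-≈ᴹ border-zero-1ᴹ) (sym (*-identityˡ _))
    where open IsAlternatingMultilinear isAM
  border-1ᴹ-sign {suc m} {f} isAM (suc j) = begin
    f (border (suc j) 1ᴹ)                                 ≈⟨ -‿involutive _ ⟨
    - - f (border (suc j) 1ᴹ)                             ≈⟨ -‿cong (swapRows (λ ()) (border (suc j) 1ᴹ)) ⟨
    - f (border (suc j) 1ᴹ ∘ transpose zero (suc zero))   ≈⟨ -‿cong (respects-≈ᴹ (border-suc-1ᴹ j)) ⟩
    - f (border zero (border j 1ᴹ))                       ≈⟨ -‿cong (border-1ᴹ-sign (border-isAlternatingMultilinear isAM zero) j) ⟩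
    - (sign (toℕ j) * f (border zero 1ᴹ))                 ≈⟨ -‿cong (*-congˡ (respects-≈ᴹ border-zero-1ᴹ)) ⟩
    - (sign (toℕ j) * f 1ᴹ)                               ≈⟨ -‿distribˡ-* _ _ ⟩
    - sign (toℕ j) * f 1ᴹ                                 ≈⟨ *-congʳ (sign-suc (toℕ j)) ⟨
    sign (suc (toℕ j)) * f 1ᴹ                             ∎
    where open AlternatingMultilinear isAM

  det-unique : ∀ n {f : Matrix n → Carrier} → IsAlternatingMultilinear f → ∀ X → f X ≈ det K n X * f 1ᴹ
  det-unique zero    isAM X = trans (IsAlternatingMultilinear.respects-≈ᴹ isAM (λ ())) (sym (*-identityˡ _))
  det-unique (suc m) {f} isAM X = begin
    f X                                                          ≈⟨ expandRow zero X (X zero) E X≈E X₀≈∑ ⟩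
    ∑ (λ j → X zero j * f (E j))                                 ≈⟨ ∑-cong (λ j → *-congˡ (cofactor j)) ⟩
    ∑ (λ j → X zero j * (det K m (minor X j) * (sign (toℕ j) * f 1ᴹ))) ≈⟨ ∑-cong (λ j → rearrange _ _ _ _) ⟩
    ∑ (λ j → laplaceTerm X j * f 1ᴹ)                             ≈⟨ *-distribʳ-∑ _ _ ⟨
    ∑ (laplaceTerm X) * f 1ᴹ                                     ≡⟨ ≡.cong (_* f 1ᴹ) (det-expand m X) ⟨
    det K (suc m) X * f 1ᴹ                                       ∎
    where
    open AlternatingMultilinear isAM
    E : Fin (suc m) → Matrix (suc m)
    E j = updateAt X zero (const (1ᴹ j))
    X≈E : ∀ j → AgreeOffRow zero X (E j)
    X≈E j zero    0≢0 = ⊥-elim (0≢0 ≡.refl)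
    X≈E j (suc r) _   k = refl
    X₀≈∑ : ∀ k → X zero k ≈ ∑ (λ j → X zero j * 1ᴹ j k)
    X₀≈∑ k = sym (begin
      ∑ (λ j → X zero j * 1ᴹ j k) ≈⟨ ∑-delta k (λ j j≢k → trans (*-congˡ (1ᴹ-offDiagonal j≢k)) (zeroʳ _)) ⟩
      X zero k * 1ᴹ k k           ≈⟨ *-congˡ (1ᴹ-diagonal k) ⟩
      X zero k * 1#               ≈⟨ *-identityʳ _ ⟩
      X zero k                    ∎)
    cofactor : ∀ j → f (E j) ≈ det K m (minor X j) * (sign (toℕ j) * f 1ᴹ)
    cofactor j = begin
      f (E j)                                  ≈⟨ clearColumn isAM j (E j) (λ k → refl) ⟩
      f (border j (minor X j))                 ≈⟨ det-unique m (border-isAlternatingMultilinear isAM j) (minor X j) ⟩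
      det K m (minor X j) * f (border j 1ᴹ)    ≈⟨ *-congˡ (border-1ᴹ-sign isAM j) ⟩
      det K m (minor X j) * (sign (toℕ j) * f 1ᴹ) ∎
    rearrange : ∀ x d s y → x * (d * (s * y)) ≈ (s * (x * d)) * y
    rearrange = solve 4 (λ x d s y → x :* (d :* (s :* y)) := (s :* (x :* d)) :* y) refl

  det-*ᴹ : ∀ n (X Y : Matrix n) → det K n (X *ᴹ Y) ≈ det K n X * det K n Y
  det-*ᴹ n X Y = begin
    det K n (X *ᴹ Y)               ≈⟨ det-unique n isAM X ⟩
    det K n X * det K n (1ᴹ *ᴹ Y)  ≈⟨ *-congˡ (det-cong n (*ᴹ-identityˡ Y)) ⟩
    det K n X * det K n Y          ∎
    where
    isAM : IsAlternatingMultilinear (λ X → det K n (X *ᴹ Y))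
    isAM = record
      { respects-≈ᴹ = λ A≈B → det-cong n (λ i j → ∑-cong (λ t → *-congʳ (A≈B i t)))
      ; rowLinear   = λ k X U V α X≈U X≈V Xₖ → det-rowLinear n k _ _ _ α
          (λ i i≢k j → ∑-cong (λ t → *-congʳ (X≈U i i≢k t)))
          (λ i i≢k j → ∑-cong (λ t → *-congʳ (X≈V i i≢k t)))
          (λ j → ∑-linear α (λ t → trans (*-congʳ (Xₖ t)) (distribʳ-scaled _ _ _ _)))
      ; alternating = λ a≢b X Xa≈Xb → det-alternating n a≢b (X *ᴹ Y) (λ j → ∑-cong (λ t → *-congʳ (Xa≈Xb t)))
      }
      where
      distribʳ-scaled : ∀ α u v y → (α * u + v) * y ≈ α * (u * y) + v * y
      distribʳ-scaled = solve 4 (λ α u v y → (α :* u :+ v) :* y := α :* (u :* y) :+ v :* y) refl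

  det-permuteRows : ∀ n (σ : Fin n → Fin n) (Z : Matrix n) → det K n (Z ∘ σ) ≈ det K n (1ᴹ ∘ σ) * det K n Z
  det-permuteRows n σ Z = trans (det-cong n (λ i j → sym (*ᴹ-identityˡ Z (σ i) j))) (det-*ᴹ n (1ᴹ ∘ σ) Z)

  det-zeroFirstColumn : ∀ n (X : Matrix (suc n)) → (∀ i → X i zero ≈ 0#) → det K (suc n) X ≈ 0#

  laplaceTerm-suc≈0 : ∀ n (X : Matrix (suc n)) → (∀ r → X (suc r) zero ≈ 0#) → ∀ k → laplaceTerm X (suc k) ≈ 0#
  laplaceTerm-suc≈0 (suc n) X X₀≈0 k =
    trans (*-congˡ (trans (*-congˡ (det-zeroFirstColumn n (minor X (suc k)) X₀≈0)) (zeroʳ _))) (zeroʳ _)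

  det-zeroFirstColumn n X X₀≈0 = trans (reflexive (det-expand n X)) (∑-zero term≈0)
    where
    term≈0 : ∀ j → laplaceTerm X j ≈ 0#
    term≈0 zero    = trans (*-congˡ (trans (*-congʳ (X₀≈0 zero)) (zeroˡ _))) (zeroʳ _)
    term≈0 (suc k) = laplaceTerm-suc≈0 n X (X₀≈0 ∘ suc) k

  det-firstColumnUnit : ∀ n (X : Matrix (suc n)) → X zero zero ≈ 1# → (∀ r → X (suc r) zero ≈ 0#) →
    det K (suc n) X ≈ det K n (minor X zero)
  det-firstColumnUnit n X X₀₀≈1 X₀≈0 = begin
    det K (suc n) X                       ≡⟨ det-expand n X ⟩
    ∑ (laplaceTerm X)                     ≈⟨ ∑-delta zero othersVanish ⟩
    1# * (X zero zero * det K n (minor X zero)) ≈⟨ *-identityˡ _ ⟩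
    X zero zero * det K n (minor X zero)  ≈⟨ *-congʳ X₀₀≈1 ⟩
    1# * det K n (minor X zero)           ≈⟨ *-identityˡ _ ⟩
    det K n (minor X zero)                ∎
    where
    othersVanish : ∀ k → k ≢ zero → laplaceTerm X k ≈ 0#
    othersVanish zero    0≢0 = ⊥-elim (0≢0 ≡.refl)
    othersVanish (suc k) _   = laplaceTerm-suc≈0 n X X₀≈0 k

  det-upperUnitriangular : ∀ n (U : Matrix n) → (∀ i j → toℕ j ℕ.< toℕ i → U i j ≈ 0#) → (∀ i → U i i ≈ 1#) →
    det K n U ≈ 1#
  det-upperUnitriangular zero    U lower≈0 diag≈1 = refl
  det-upperUnitriangular (suc n) U lower≈0 diag≈1 =
    trans (det-firstColumnUnit n U (diag≈1 zero) (λ r → lower≈0 (suc r) zero (s≤s z≤n)))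
          (det-upperUnitriangular n (minor U zero) (λ i j j<i → lower≈0 (suc i) (suc j) (s≤s j<i)) (diag≈1 ∘ suc))

  det-1ᴹ : ∀ n → det K n 1ᴹ ≈ 1#
  det-1ᴹ n = det-upperUnitriangular n 1ᴹ (λ i j j<i → 1ᴹ-offDiagonal (λ i≡j → ℕₚ.<-irrefl (≡.cong toℕ (≡.sym i≡j)) j<i)) 1ᴹ-diagonal

  det-upperLeftBlock : ∀ q p (X : Matrix q) (M : Matrix (q ℕ.+ p)) →
    (∀ i j → M (i ↑ˡ p) (j ↑ˡ p) ≈ X i j) → (∀ i k → M (i ↑ˡ p) (q ↑ʳ k) ≈ 0#) →
    (∀ l k → M (q ↑ʳ l) (q ↑ʳ k) ≈ 1ᴹ l k) → det K (q ℕ.+ p) M ≈ det K q X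
  det-upperLeftBlock zero    p X M M≈X M≈0 M≈1 = trans (det-cong p M≈1) (det-1ᴹ p)
  det-upperLeftBlock (suc q) p X M M≈X M≈0 M≈1 = begin
    det K (suc q ℕ.+ p) M                                                   ≡⟨ det-expand (q ℕ.+ p) M ⟩
    ∑ (laplaceTerm M)                                                       ≈⟨ ∑-splitAt (suc q) p _ ⟩
    ∑ (λ i → laplaceTerm M (i ↑ˡ p)) + ∑ (λ k → laplaceTerm M (suc q ↑ʳ k)) ≈⟨ +-cong (∑-cong leftTerm) (∑-zero rightTerm) ⟩
    ∑ (laplaceTerm X) + 0#                                                  ≈⟨ +-identityʳ _ ⟩
    ∑ (laplaceTerm X)                                                       ≡⟨ det-expand q X ⟨
    det K (suc q) X                                                         ∎
    where
    leftTerm : ∀ i → laplaceTerm M (i ↑ˡ p) ≈ laplaceTerm X i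
    leftTerm i = *-cong (reflexive (≡.cong sign (Finₚ.toℕ-↑ˡ i p))) (*-cong (M≈X zero i)
      (det-upperLeftBlock q p (minor X i) (minor M (i ↑ˡ p))
        (λ r s → trans (reflexive (≡.cong (M (suc r ↑ˡ p)) (punchIn-↑ˡ p i s))) (M≈X (suc r) _))
        (λ r k → trans (reflexive (≡.cong (M (suc r ↑ˡ p)) (punchIn-↑ʳ i k))) (M≈0 (suc r) k))
        (λ l k → trans (reflexive (≡.cong (M (suc q ↑ʳ l)) (punchIn-↑ʳ i k))) (M≈1 l k))))
    rightTerm : ∀ k → laplaceTerm M (suc q ↑ʳ k) ≈ 0#
    rightTerm k = trans (*-congˡ (trans (*-congʳ (M≈0 zero k)) (zeroˡ _))) (zeroʳ _)

  det-lowerRightBlock : ∀ q p (X : Matrix p) (M : Matrix (q ℕ.+ p)) →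
    (∀ i j → M (i ↑ˡ p) (j ↑ˡ p) ≈ 1ᴹ i j) → (∀ l j → M (q ↑ʳ l) (j ↑ˡ p) ≈ 0#) →
    (∀ l k → M (q ↑ʳ l) (q ↑ʳ k) ≈ X l k) → det K (q ℕ.+ p) M ≈ det K p X
  det-lowerRightBlock zero    p X M M≈1 M≈0 M≈X = det-cong p M≈X
  det-lowerRightBlock (suc q) p X M M≈1 M≈0 M≈X =
    trans (det-firstColumnUnit (q ℕ.+ p) M (trans (M≈1 zero zero) (1ᴹ-diagonal {suc q} zero)) firstColumn)
          (det-lowerRightBlock q p X (minor M zero)
            (λ i j → trans (M≈1 (suc i) (suc j)) (1ᴹ-reindex suc-injective i j))
            (λ l j → M≈0 l (suc j))
            M≈X)
    where
    firstColumn : ∀ r → M (suc r) zero ≈ 0#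
    firstColumn r with splitAtView q p r
    ... | left i  = trans (M≈1 (suc i) zero) (1ᴹ-offDiagonal {i = suc i} {zero} (λ ()))
    ... | right l = M≈0 l zero

-- Partitions and their positions

countFin-cong : ∀ {q} {P Q : Fin q → Bool} → (∀ j → P j ≡ Q j) → countFin P ≡ countFin Q
countFin-cong {zero}  P≡Q = ≡.refl
countFin-cong {suc q} P≡Q = ≡.cong₂ ℕ._+_ (≡.cong (λ b → if b then 1 else 0) (P≡Q zero)) (countFin-cong (P≡Q ∘ suc))

countFin≤ : ∀ {q} (P : Fin q → Bool) → countFin P ℕ.≤ q
countFin≤ {zero}  P = z≤n
countFin≤ {suc q} P with P zero
... | true  = s≤s (countFin≤ (P ∘ suc))
... | false = ℕₚ.m≤n⇒m≤1+n (countFin≤ (P ∘ suc))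

countFin-prefix : ∀ {q} (P : Fin q → Bool) m → m ℕ.≤ q →
  (∀ j → toℕ j ℕ.< m → P j ≡ true) → (∀ j → m ℕ.≤ toℕ j → P j ≡ false) → countFin P ≡ m
countFin-prefix {zero}  P zero    _         _     _      = ≡.refl
countFin-prefix {suc q} P zero    _         _     after rewrite after zero z≤n =
  countFin-prefix (P ∘ suc) zero z≤n (λ _ ()) (λ j _ → after (suc j) z≤n)
countFin-prefix {suc q} P (suc m) (s≤s m≤q) below after rewrite below zero (s≤s z≤n) =
  ≡.cong suc (countFin-prefix (P ∘ suc) m m≤q (λ j j<m → below (suc j) (s≤s j<m)) (λ j m≤j → after (suc j) (s≤s m≤j)))

sumFin-cong : ∀ {q} {f g : Fin q → ℕ} → (∀ j → f j ≡ g j) → sumFin f ≡ sumFin g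
sumFin-cong {zero}  _   = ≡.refl
sumFin-cong {suc q} f≡g = ≡.cong₂ ℕ._+_ (f≡g zero) (sumFin-cong (f≡g ∘ suc))

sumFin-zero : ∀ {q} (f : Fin q → ℕ) → sumFin f ≡ 0 → ∀ j → f j ≡ 0
sumFin-zero f ∑≡0 zero    = ℕₚ.m+n≡0⇒m≡0 (f zero) ∑≡0
sumFin-zero f ∑≡0 (suc j) = sumFin-zero (f ∘ suc) (ℕₚ.m+n≡0⇒n≡0 (f zero) ∑≡0) j

sumFin-decrement : ∀ {q} (f g : Fin q → ℕ) (i : Fin q) → f i ≡ suc (g i) → (∀ j → j ≢ i → f j ≡ g j) →
  sumFin f ≡ suc (sumFin g)
sumFin-decrement f g zero fᵢ others = ≡.cong₂ ℕ._+_ fᵢ (sumFin-cong (λ j → others (suc j) (λ ())))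
sumFin-decrement f g (suc i) fᵢ others = ≡.trans
  (≡.cong₂ ℕ._+_ (others zero (λ ()))
    (sumFin-decrement (f ∘ suc) (g ∘ suc) i fᵢ (λ j j≢i → others (suc j) (j≢i ∘ Finₚ.suc-injective))))
  (ℕₚ.+-suc (g zero) _)

lastNonzero : ∀ {q} (f : Fin q → ℕ) {m} → sumFin f ≡ suc m →
  ∃₂ λ i κ → f i ≡ suc κ × (∀ j → toℕ i ℕ.< toℕ j → f j ≡ 0)
lastNonzero {suc q} f {m} ∑≡1+m with sumFin (f ∘ suc) in tail≡
... | suc m′ with lastNonzero (f ∘ suc) tail≡
...   | i , κ , fᵢ , after = suc i , κ , fᵢ , λ { zero () ; (suc j) (s≤s i<j) → after j i<j }
lastNonzero {suc q} f {m} ∑≡1+m | zero =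
  zero , m , ≡.trans (≡.sym (ℕₚ.+-identityʳ (f zero))) ∑≡1+m , λ { zero () ; (suc j) _ → sumFin-zero (f ∘ suc) tail≡ j }

conj-prefix : ∀ {q} p (L : Fin q → ℕ) k m → m ℕ.≤ q →
  (∀ j → toℕ j ℕ.< m → suc (toℕ k) ℕ.≤ L j) → (∀ j → m ℕ.≤ toℕ j → L j ℕ.≤ toℕ k) → conj p L k ≡ m
conj-prefix p L k m m≤q below after = countFin-prefix _ m m≤q
  (λ j j<m → ≡.trans (isYes≗does _) (dec-true (suc (toℕ k) ℕ.≤? L j) (below j j<m)))
  (λ j m≤j → ≡.trans (isYes≗does _) (dec-false (suc (toℕ k) ℕ.≤? L j) (ℕₚ.<⇒≱ (s≤s (after j m≤j)))))

conj-zero : ∀ {q} p (L : Fin q → ℕ) → (∀ j → L j ≡ 0) → ∀ k → conj p L k ≡ 0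
conj-zero p L L≡0 k = conj-prefix p L k 0 z≤n (λ _ ()) (λ j _ → ℕₚ.≤-trans (ℕₚ.≤-reflexive (L≡0 j)) z≤n)

isYes-⇔ : ∀ {A B : Set} (a? : Dec A) (b? : Dec B) → (A → B) → (B → A) → ⌊ a? ⌋ ≡ ⌊ b? ⌋
isYes-⇔ (yes _) (yes _) _   _   = ≡.refl
isYes-⇔ (no _)  (no _)  _   _   = ≡.refl
isYes-⇔ (yes a) (no ¬b) A→B _   = ⊥-elim (¬b (A→B a))
isYes-⇔ (no ¬a) (yes b) _   B→A = ⊥-elim (¬a (B→A b))

module Positions (q p : ℕ) where

  Bounded : (Fin q → ℕ) → Set
  Bounded L = ∀ j → L j ℕ.≤ p

  -- partPosition and conjPosition are λᵢ - i - 1 and k - λ′ₖ shifted by q into [0, q + p).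
  partPosition : (Fin q → ℕ) → Fin q → ℕ
  partPosition L i = L i ℕ.+ (q ∸ suc (toℕ i))

  conjPosition : (Fin q → ℕ) → Fin p → ℕ
  conjPosition L k = toℕ k ℕ.+ (q ∸ conj p L k)

  position : (Fin q → ℕ) → Fin (q ℕ.+ p) → ℕ
  position L = [ partPosition L , conjPosition L ]′ ∘ splitAt q

  position-↑ˡ : ∀ L i → position L (i ↑ˡ p) ≡ partPosition L i
  position-↑ˡ L i = ≡.cong [ partPosition L , conjPosition L ]′ (Finₚ.splitAt-↑ˡ q i p)

  position-↑ʳ : ∀ L k → position L (q ↑ʳ k) ≡ conjPosition L k
  position-↑ʳ L k = ≡.cong [ partPosition L , conjPosition L ]′ (Finₚ.splitAt-↑ʳ q p k)

  position< : ∀ {L} → Bounded L → ∀ r → position L r ℕ.< q ℕ.+ p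
  position< {L} L≤p r with splitAtView q p r
  ... | left i rewrite position-↑ˡ L i = ℕₚ.≤-trans (ℕₚ.≤-reflexive (≡.sym (ℕₚ.+-suc (L i) _)))
    (ℕₚ.≤-trans (ℕₚ.+-mono-≤ (L≤p i) (ℕₚ.∸-monoʳ-< {o = 0} (s≤s z≤n) (Finₚ.toℕ<n i))) (ℕₚ.≤-reflexive (ℕₚ.+-comm p q)))
  ... | right k rewrite position-↑ʳ L k =
    ℕₚ.≤-trans (ℕₚ.+-mono-≤ (Finₚ.toℕ<n k) (ℕₚ.m∸n≤m q (conj p L k))) (ℕₚ.≤-reflexive (ℕₚ.+-comm p q))

  positions : ∀ {L} → Bounded L → Fin (q ℕ.+ p) → Fin (q ℕ.+ p)
  positions L≤p r = fromℕ< (position< L≤p r)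

  empty : Fin q → ℕ
  empty _ = 0

  empty-bounded : Bounded empty
  empty-bounded _ = z≤n

  conjPosition-empty : ∀ k → conjPosition empty k ≡ toℕ k ℕ.+ q
  conjPosition-empty k = ≡.cong (λ c → toℕ k ℕ.+ (q ∸ c)) (conj-zero p empty (λ _ → ≡.refl) k)

  partPosition-empty<conjPosition-empty : ∀ i k → partPosition empty i ℕ.< conjPosition empty k
  partPosition-empty<conjPosition-empty i k = ℕₚ.<-≤-trans (ℕₚ.∸-monoʳ-< {o = 0} (s≤s z≤n) (Finₚ.toℕ<n i))
    (ℕₚ.≤-trans (ℕₚ.m≤n+m q (toℕ k)) (ℕₚ.≤-reflexive (≡.sym (conjPosition-empty k))))

  position-empty-injective : Injective _≡_ _≡_ (position empty)
  position-empty-injective {r} {s} with splitAtView q p r | splitAtView q p s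
  ... | left i  | left j  = λ eq → ≡.cong (_↑ˡ p) (Finₚ.toℕ-injective (ℕₚ.suc-injective
    (ℕₚ.∸-cancelˡ-≡ (Finₚ.toℕ<n i) (Finₚ.toℕ<n j) (≡.trans (≡.sym (position-↑ˡ empty i)) (≡.trans eq (position-↑ˡ empty j))))))
  ... | right k | right l = λ eq → ≡.cong (q ↑ʳ_) (Finₚ.toℕ-injective (ℕₚ.+-cancelʳ-≡ _ _ _
    (≡.trans (≡.sym (≡.trans (position-↑ʳ empty k) (conjPosition-empty k)))
             (≡.trans eq (≡.trans (position-↑ʳ empty l) (conjPosition-empty l))))))
  ... | left i  | right k = λ eq → ⊥-elim (ℕₚ.<⇒≢ (partPosition-empty<conjPosition-empty i k)
    (≡.trans (≡.sym (position-↑ˡ empty i)) (≡.trans eq (position-↑ʳ empty k))))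
  ... | right k | left i  = λ eq → ⊥-elim (ℕₚ.<⇒≢ (partPosition-empty<conjPosition-empty i k)
    (≡.trans (≡.sym (position-↑ˡ empty i)) (≡.trans (≡.sym eq) (position-↑ʳ empty k))))

  position-sizeZero : ∀ L → sumFin L ≡ 0 → ∀ r → position L r ≡ position empty r
  position-sizeZero L |L|≡0 r with splitAtView q p r
  ... | left i  rewrite position-↑ˡ L i | position-↑ˡ empty i = ≡.cong (ℕ._+ (q ∸ suc (toℕ i))) (sumFin-zero L |L|≡0 i)
  ... | right k rewrite position-↑ʳ L k | position-↑ʳ empty k =
    ≡.cong (λ c → toℕ k ℕ.+ (q ∸ c)) (≡.trans (conj-zero p L (sumFin-zero L |L|≡0) k) (≡.sym (conj-zero p empty (λ _ → ≡.refl) k)))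

  shift : ℕ → ℤ
  shift t = + t ℤ.- + q

  shift-< : ∀ {s t} → s ℕ.< t → shift s ℤ.< shift t
  shift-< s<t = ℤₚ.+-monoˡ-< (ℤ.- + q) (ℤ.+<+ s<t)

  shift-+ : ∀ R u → shift (R ℕ.+ u) ≡ shift R ℤ.+ + u
  shift-+ R u = ≡.trans (≡.cong (ℤ._- + q) (ℤₚ.pos-+ R u))
    (solve 3 (λ r u q → (r :+ u) :- q := (r :- q) :+ u) ≡.refl (+ R) (+ u) (+ q))
    where open +-*-Solver

  shift-partPosition : ∀ L i → shift (partPosition L i) ≡ + L i ℤ.- + suc (toℕ i)
  shift-partPosition L i = begin
    + (L i ℕ.+ d) ℤ.- + q                 ≡⟨ ≡.cong (λ n → + (L i ℕ.+ d) ℤ.- + n) (ℕₚ.m∸n+n≡m (Finₚ.toℕ<n i)) ⟨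
    + (L i ℕ.+ d) ℤ.- + (d ℕ.+ suc (toℕ i)) ≡⟨ ≡.cong₂ ℤ._-_ (ℤₚ.pos-+ (L i) d) (ℤₚ.pos-+ d (suc (toℕ i))) ⟩
    (+ L i ℤ.+ + d) ℤ.- (+ d ℤ.+ + suc (toℕ i))
      ≡⟨ solve 3 (λ a d s → (a :+ d) :- (d :+ s) := a :- s) ≡.refl (+ L i) (+ d) (+ suc (toℕ i)) ⟩
    + L i ℤ.- + suc (toℕ i)               ∎
    where
    open ≡.≡-Reasoning
    open +-*-Solver
    d = q ∸ suc (toℕ i)

  shift-conjPosition : ∀ L k → shift (conjPosition L k) ≡ + suc (toℕ k) ℤ.- + conj p L k ℤ.- + 1
  shift-conjPosition L k = begin
    + (toℕ k ℕ.+ d) ℤ.- + q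
      ≡⟨ ≡.cong (λ n → + (toℕ k ℕ.+ d) ℤ.- + n) (ℕₚ.m∸n+n≡m {q} (countFin≤ (λ j → ⌊ suc (toℕ k) ℕ.≤? L j ⌋))) ⟨
    + (toℕ k ℕ.+ d) ℤ.- + (d ℕ.+ conj p L k) ≡⟨ ≡.cong₂ ℤ._-_ (ℤₚ.pos-+ (toℕ k) d) (ℤₚ.pos-+ d (conj p L k)) ⟩
    (+ toℕ k ℤ.+ + d) ℤ.- (+ d ℤ.+ + conj p L k)
      ≡⟨ solve 4 (λ k d c o → (k :+ d) :- (d :+ c) := (o :+ k) :- c :- o) ≡.refl (+ toℕ k) (+ d) (+ conj p L k) (+ 1) ⟩
    (+ 1 ℤ.+ + toℕ k) ℤ.- + conj p L k ℤ.- + 1 ≡⟨ ≡.cong (λ n → n ℤ.- + conj p L k ℤ.- + 1) (ℤₚ.pos-+ 1 (toℕ k)) ⟨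
    + suc (toℕ k) ℤ.- + conj p L k ℤ.- + 1  ∎
    where
    open ≡.≡-Reasoning
    open +-*-Solver
    d = q ∸ conj p L k

  -- Removing the last box of the last nonempty row i exchanges the positions of row i and column λᵢ - 1.
  record CornerRemoval (L : Fin q → ℕ) (m : ℕ) : Set where
    field
      L′             : Fin q → ℕ
      L′-isPartition : IsPartition L′
      L′-bounded     : Bounded L′
      L′-size        : sumFin L′ ≡ m
      row            : Fin q
      column         : Fin p
      position-swap  : ∀ r → position L r ≡ position L′ (transpose (row ↑ˡ p) (q ↑ʳ column) r)

  module Corner {L : Fin q → ℕ} (L-isPartition : IsPartition L) (L-bounded : Bounded L)
    (i : Fin q) {κ} (Lᵢ≡1+κ : L i ≡ suc κ) (zeroAfter : ∀ j → toℕ i ℕ.< toℕ j → L j ≡ 0) where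

    L′ : Fin q → ℕ
    L′ = updateAt L i ℕ.pred

    L′-at : L′ i ≡ κ
    L′-at = ≡.trans (updateAt-updates i L) (≡.cong ℕ.pred Lᵢ≡1+κ)

    L′-others : ∀ {j} → j ≢ i → L′ j ≡ L j
    L′-others {j} j≢i = updateAt-minimal j i L j≢i

    L′≤L : ∀ j → L′ j ℕ.≤ L j
    L′≤L j with j ≟ i
    ... | yes ≡.refl = ℕₚ.≤-trans (ℕₚ.≤-reflexive L′-at) (ℕₚ.≤-trans (ℕₚ.n≤1+n κ) (ℕₚ.≤-reflexive (≡.sym Lᵢ≡1+κ)))
    ... | no j≢i     = ℕₚ.≤-reflexive (L′-others j≢i)

    i≤⇒i< : ∀ {j} → toℕ i ℕ.≤ toℕ j → j ≢ i → toℕ i ℕ.< toℕ j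
    i≤⇒i< i≤j j≢i = ℕₚ.≤∧≢⇒< i≤j (j≢i ∘ Finₚ.toℕ-injective ∘ ≡.sym)

    L′-isPartition : IsPartition L′
    L′-isPartition x y x≤y with x ≟ i | y ≟ i
    ... | yes ≡.refl | yes ≡.refl = ℕₚ.≤-refl
    ... | yes ≡.refl | no y≢i     = ℕₚ.≤-trans (ℕₚ.≤-reflexive (≡.trans (L′-others y≢i) (zeroAfter y (i≤⇒i< x≤y y≢i)))) z≤n
    ... | no x≢i     | yes ≡.refl = ℕₚ.≤-trans (L′≤L y) (ℕₚ.≤-trans (L-isPartition x y x≤y) (ℕₚ.≤-reflexive (≡.sym (L′-others x≢i))))
    ... | no x≢i     | no y≢i     = ℕₚ.≤-trans (ℕₚ.≤-reflexive (L′-others y≢i))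
                                      (ℕₚ.≤-trans (L-isPartition x y x≤y) (ℕₚ.≤-reflexive (≡.sym (L′-others x≢i))))

    L′-bounded : Bounded L′
    L′-bounded j = ℕₚ.≤-trans (L′≤L j) (L-bounded j)

    L-decrements : sumFin L ≡ suc (sumFin L′)
    L-decrements = sumFin-decrement L L′ i (≡.trans Lᵢ≡1+κ (≡.cong suc (≡.sym L′-at))) (λ j j≢i → ≡.sym (L′-others j≢i))

    κ<p : κ ℕ.< p
    κ<p = ℕₚ.≤-trans (ℕₚ.≤-reflexive (≡.sym Lᵢ≡1+κ)) (L-bounded i)

    k : Fin p
    k = fromℕ< κ<p

    1+k≡Lᵢ : suc (toℕ k) ≡ L i
    1+k≡Lᵢ = ≡.trans (≡.cong suc (Finₚ.toℕ-fromℕ< κ<p)) (≡.sym Lᵢ≡1+κ)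

    conj-L : conj p L k ≡ suc (toℕ i)
    conj-L = conj-prefix p L k (suc (toℕ i)) (Finₚ.toℕ<n i)
      (λ j j≤i → ℕₚ.≤-trans (ℕₚ.≤-reflexive 1+k≡Lᵢ) (L-isPartition j i (ℕₚ.≤-pred j≤i)))
      (λ j i<j → ℕₚ.≤-trans (ℕₚ.≤-reflexive (zeroAfter j i<j)) z≤n)

    conj-L′ : conj p L′ k ≡ toℕ i
    conj-L′ = conj-prefix p L′ k (toℕ i) (ℕₚ.<⇒≤ (Finₚ.toℕ<n i))
      (λ j j<i → ℕₚ.≤-trans (ℕₚ.≤-reflexive 1+k≡Lᵢ) (ℕₚ.≤-trans (L-isPartition j i (ℕₚ.<⇒≤ j<i))
                   (ℕₚ.≤-reflexive (≡.sym (L′-others (ℕₚ.<⇒≢ j<i ∘ ≡.cong toℕ))))))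
      after
      where
      after : ∀ j → toℕ i ℕ.≤ toℕ j → L′ j ℕ.≤ toℕ k
      after j i≤j with j ≟ i
      ... | yes ≡.refl = ℕₚ.≤-reflexive (≡.trans L′-at (≡.sym (Finₚ.toℕ-fromℕ< κ<p)))
      ... | no j≢i     = ℕₚ.≤-trans (ℕₚ.≤-reflexive (≡.trans (L′-others j≢i) (zeroAfter j (i≤⇒i< i≤j j≢i)))) z≤n

    conj-others : ∀ {k′} → k′ ≢ k → conj p L k′ ≡ conj p L′ k′
    conj-others {k′} k′≢k = countFin-cong sameTest
      where
      sameTest : ∀ j → ⌊ suc (toℕ k′) ℕ.≤? L j ⌋ ≡ ⌊ suc (toℕ k′) ℕ.≤? L′ j ⌋
      sameTest j with j ≟ i
      ... | no j≢i     = ≡.cong (λ n → ⌊ suc (toℕ k′) ℕ.≤? n ⌋) (≡.sym (L′-others j≢i))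
      ... | yes ≡.refl = isYes-⇔ _ _
        (λ k′<Lᵢ → ℕₚ.≤-trans (ℕₚ.≤∧≢⇒< (ℕₚ.≤-pred (ℕₚ.≤-trans k′<Lᵢ (ℕₚ.≤-reflexive Lᵢ≡1+κ))) k′≢κ) (ℕₚ.≤-reflexive (≡.sym L′-at)))
        (λ k′<L′ᵢ → ℕₚ.≤-trans k′<L′ᵢ (L′≤L i))
        where
        k′≢κ : toℕ k′ ≢ κ
        k′≢κ k′≡κ = k′≢k (Finₚ.toℕ-injective (≡.trans k′≡κ (≡.sym (Finₚ.toℕ-fromℕ< κ<p))))

    partPosition≡conjPosition : partPosition L i ≡ conjPosition L′ k
    partPosition≡conjPosition = begin
      L i ℕ.+ (q ∸ suc (toℕ i))        ≡⟨ ≡.cong (ℕ._+ (q ∸ suc (toℕ i))) 1+k≡Lᵢ ⟨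
      suc (toℕ k) ℕ.+ (q ∸ suc (toℕ i)) ≡⟨ ℕₚ.+-suc (toℕ k) _ ⟨
      toℕ k ℕ.+ suc (q ∸ suc (toℕ i))   ≡⟨ ≡.cong (toℕ k ℕ.+_) (ℕₚ.+-∸-assoc 1 (Finₚ.toℕ<n i)) ⟨
      toℕ k ℕ.+ (q ∸ toℕ i)             ≡⟨ ≡.cong (λ c → toℕ k ℕ.+ (q ∸ c)) conj-L′ ⟨
      toℕ k ℕ.+ (q ∸ conj p L′ k)       ∎
      where open ≡.≡-Reasoning

    conjPosition≡partPosition : conjPosition L k ≡ partPosition L′ i
    conjPosition≡partPosition =
      ≡.cong₂ (λ a c → a ℕ.+ (q ∸ c)) (≡.trans (Finₚ.toℕ-fromℕ< κ<p) (≡.sym L′-at)) conj-L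

    a b : Fin (q ℕ.+ p)
    a = i ↑ˡ p
    b = q ↑ʳ k

    position-unchanged : ∀ r → r ≢ a → r ≢ b → position L r ≡ position L′ r
    position-unchanged r with splitAtView q p r
    ... | left j  = λ j≢i _ → ≡.trans (position-↑ˡ L j) (≡.trans
                      (≡.cong (ℕ._+ (q ∸ suc (toℕ j))) (≡.sym (L′-others (j≢i ∘ ≡.cong (_↑ˡ p))))) (≡.sym (position-↑ˡ L′ j)))
    ... | right k′ = λ _ k′≢k → ≡.trans (position-↑ʳ L k′) (≡.trans
                      (≡.cong (λ c → toℕ k′ ℕ.+ (q ∸ c)) (conj-others (k′≢k ∘ ≡.cong (q ↑ʳ_)))) (≡.sym (position-↑ʳ L′ k′)))

    position-swap : ∀ r → position L r ≡ position L′ (transpose a b r)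
    position-swap = ≗-byCases a b
      (≡.trans (position-↑ˡ L i) (≡.trans partPosition≡conjPosition
        (≡.trans (≡.sym (position-↑ʳ L′ k)) (≡.cong (position L′) (≡.sym (transpose-matchˡ a b))))))
      (≡.trans (position-↑ʳ L k) (≡.trans conjPosition≡partPosition
        (≡.trans (≡.sym (position-↑ˡ L′ i)) (≡.cong (position L′) (≡.sym (transpose-matchʳ a b))))))
      (λ r r≢a r≢b → ≡.trans (position-unchanged r r≢a r≢b) (≡.cong (position L′) (≡.sym (transpose-others r≢a r≢b))))

  removeCorner : ∀ {L m} → IsPartition L → Bounded L → sumFin L ≡ suc m → CornerRemoval L m
  removeCorner {L} L-isPartition L-bounded |L|≡1+m with lastNonzero L |L|≡1+m
  ... | i , κ , Lᵢ≡1+κ , zeroAfter = record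
    { L′             = L′
    ; L′-isPartition = L′-isPartition
    ; L′-bounded     = L′-bounded
    ; L′-size        = ℕₚ.suc-injective (≡.trans (≡.sym L-decrements) |L|≡1+m)
    ; row            = i
    ; column         = k
    ; position-swap  = position-swap
    }
    where open Corner L-isPartition L-bounded i Lᵢ≡1+κ zeroAfter

  position-injective : ∀ m {L} → IsPartition L → Bounded L → sumFin L ≡ m → Injective _≡_ _≡_ (position L)
  position-injective zero    {L} _ _ |L|≡0 {r} {s} eq =
    position-empty-injective (≡.trans (≡.sym (position-sizeZero L |L|≡0 r)) (≡.trans eq (position-sizeZero L |L|≡0 s)))
  position-injective (suc m) L-isPartition L-bounded |L|≡1+m {r} {s} eq =
    ≡.trans (≡.sym (transpose-inverse _ _)) (≡.trans (≡.cong (transpose _ _) τr≡τs) (transpose-inverse _ _))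
    where
    open CornerRemoval (removeCorner L-isPartition L-bounded |L|≡1+m)
    τr≡τs = position-injective m L′-isPartition L′-bounded L′-size
      (≡.trans (≡.sym (position-swap r)) (≡.trans eq (position-swap s)))

  positions-injective : ∀ {L} → IsPartition L → (L≤p : Bounded L) → Injective _≡_ _≡_ (positions L≤p)
  positions-injective L-isPartition L≤p eq = position-injective _ L-isPartition L≤p ≡.refl
    (≡.trans (≡.sym (Finₚ.toℕ-fromℕ< _)) (≡.trans (≡.cong toℕ eq) (Finₚ.toℕ-fromℕ< _)))

-- Complementary minors

module ComplementaryMinors {c ℓ : Level} (K : CommutativeRing c ℓ) (q p : ℕ) where

  open CommutativeRing K hiding (zero)
  open import Algebra.Properties.Ring ring using (-‿distribˡ-*)
  open Determinant K
  open Positions q p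
  open import Relation.Binary.Reasoning.Setoid setoid

  N : ℕ
  N = q ℕ.+ p

  det-∘positions : ∀ m {L} → IsPartition L → (L≤p : Bounded L) → sumFin L ≡ m →
    ∀ Z → det K N (Z ∘ positions L≤p) ≈ sign m * det K N (Z ∘ positions empty-bounded)
  det-∘positions zero {L} _ L≤p |L|≡0 Z = trans (det-cong N samePositions) (sym (*-identityˡ _))
    where
    samePositions : Z ∘ positions L≤p ≈ᴹ Z ∘ positions empty-bounded
    samePositions r j = reflexive (≡.cong (λ x → Z x j) (Finₚ.fromℕ<-cong _ _ (position-sizeZero L |L|≡0 r) _ _))
  det-∘positions (suc m) L-isPartition L≤p |L|≡1+m Z = begin
    det K N (Z ∘ positions L≤p)                                  ≈⟨ det-cong N swapped ⟩
    det K N (Z ∘ positions L′-bounded ∘ transpose a b)           ≈⟨ det-swapRows N (↑ˡ≢↑ʳ row column) _ ⟩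
    - det K N (Z ∘ positions L′-bounded)                         ≈⟨ -‿cong (det-∘positions m L′-isPartition L′-bounded L′-size Z) ⟩
    - (sign m * det K N (Z ∘ positions empty-bounded))           ≈⟨ -‿distribˡ-* _ _ ⟩
    - sign m * det K N (Z ∘ positions empty-bounded)             ≈⟨ *-congʳ (sign-suc m) ⟨
    sign (suc m) * det K N (Z ∘ positions empty-bounded)         ∎
    where
    open CornerRemoval (removeCorner L-isPartition L≤p |L|≡1+m)
    a = row ↑ˡ p
    b = q ↑ʳ column
    swapped : Z ∘ positions L≤p ≈ᴹ Z ∘ positions L′-bounded ∘ transpose a b
    swapped r j = reflexive (≡.cong (λ x → Z x j) (Finₚ.fromℕ<-cong _ _ (position-swap r) _ _))

  sumUpTo-cong : ∀ m {g h : ℕ → Carrier} → (∀ t → g t ≈ h t) → sumUpTo K m g ≈ sumUpTo K m h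
  sumUpTo-cong zero    g≈h = g≈h 0
  sumUpTo-cong (suc m) g≈h = +-cong (sumUpTo-cong m g≈h) (g≈h (suc m))

  sumUpTo-suc : ∀ m (g : ℕ → Carrier) → sumUpTo K (suc m) g ≈ g 0 + sumUpTo K m (g ∘ suc)
  sumUpTo-suc zero    g = refl
  sumUpTo-suc (suc m) g = trans (+-congʳ (sumUpTo-suc m g)) (+-assoc _ _ _)

  ∑-window : ∀ n (g : ℕ → Carrier) R m → R ℕ.+ m ℕ.< n →
    (∀ t → t ℕ.< R → g t ≈ 0#) → (∀ t → R ℕ.+ m ℕ.< t → g t ≈ 0#) →
    ∑ (λ (t : Fin n) → g (toℕ t)) ≈ sumUpTo K m (λ u → g (R ℕ.+ u))
  ∑-window (suc n) g (suc R) m (s≤s R+m<n) below above = begin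
    ∑ (λ t → g (toℕ t))                  ≡⟨ ∑-suc _ ⟩
    g 0 + ∑ (λ t → g (suc (toℕ t)))
      ≈⟨ +-cong (below 0 (s≤s z≤n)) (∑-window n (g ∘ suc) R m R+m<n (λ t → below (suc t) ∘ s≤s) (λ t → above (suc t) ∘ s≤s)) ⟩
    0# + sumUpTo K m (λ u → g (suc R ℕ.+ u)) ≈⟨ +-identityˡ _ ⟩
    sumUpTo K m (λ u → g (suc R ℕ.+ u))  ∎
  ∑-window (suc n) g zero zero _ below above = begin
    ∑ (λ t → g (toℕ t))                  ≡⟨ ∑-suc _ ⟩
    g 0 + ∑ (λ t → g (suc (toℕ t)))      ≈⟨ +-congˡ (∑-zero (λ t → above (suc (toℕ t)) (s≤s z≤n))) ⟩
    g 0 + 0#                             ≈⟨ +-identityʳ _ ⟩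
    g 0                                  ∎
  ∑-window (suc n) g zero (suc m) (s≤s m<n) below above = begin
    ∑ (λ t → g (toℕ t))                  ≡⟨ ∑-suc _ ⟩
    g 0 + ∑ (λ t → g (suc (toℕ t)))      ≈⟨ +-congˡ (∑-window n (g ∘ suc) zero m m<n (λ _ ()) (λ t → above (suc t) ∘ s≤s)) ⟩
    g 0 + sumUpTo K m (g ∘ suc)          ≈⟨ sumUpTo-suc m g ⟨
    sumUpTo K (suc m) g                  ∎

  δ≈1ᴹ : ∀ m {r s : Fin N} → toℕ r ℕ.+ m ≡ toℕ s → δ K m ≈ 1ᴹ r s
  δ≈1ᴹ zero    {r} r+0≡s = sym (trans (reflexive (≡.cong (1ᴹ r)
                             (≡.sym (Finₚ.toℕ-injective (≡.trans (≡.sym (ℕₚ.+-identityʳ _)) r+0≡s))))) (1ᴹ-diagonal r))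
  δ≈1ᴹ (suc m) {r} r+1+m≡s = sym (1ᴹ-offDiagonal (λ r≡s → ℕₚ.m+1+n≢m (toℕ r) (≡.trans r+1+m≡s (≡.cong toℕ (≡.sym r≡s)))))

  ι : Fin N → ℤ
  ι = shift ∘ toℕ

  ι-positions-↑ˡ : ∀ {L} (L≤p : Bounded L) i → ι (positions L≤p (i ↑ˡ p)) ≡ + L i ℤ.- + suc (toℕ i)
  ι-positions-↑ˡ {L} L≤p i = ≡.trans (≡.cong shift (≡.trans (Finₚ.toℕ-fromℕ< _) (position-↑ˡ L i)))
                                     (shift-partPosition L i)

  ι-positions-↑ʳ : ∀ {L} (L≤p : Bounded L) k →
    ι (positions L≤p (q ↑ʳ k)) ≡ + suc (toℕ k) ℤ.- + conj p L k ℤ.- + 1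
  ι-positions-↑ʳ {L} L≤p k = ≡.trans (≡.cong shift (≡.trans (Finₚ.toℕ-fromℕ< _) (position-↑ʳ L k)))
                                     (shift-conjPosition L k)

  module Window (b cc : ZMatrix K) (b-upper : IsUpperUnitriangular K b) (cc-inverse : IsInverse K b cc) where

    A A′ : Matrix N
    A  u v = b  (ι u) (ι v)
    A′ u v = cc (ι u) (ι v)

    cc-lower≈0 : ∀ i j → j ℤ.< i → cc i j ≈ 0#
    cc-lower≈0 = proj₁ (proj₁ cc-inverse)

    det-A′ : det K N A′ ≈ 1#
    det-A′ = det-upperUnitriangular N A′ (λ u v v<u → cc-lower≈0 _ _ (shift-< v<u)) (λ u → proj₂ (proj₁ cc-inverse) (ι u))

    A′*A≈1 : A′ *ᴹ A ≈ᴹ 1ᴹ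
    A′*A≈1 r s with toℕ r ℕ.≤? toℕ s
    ... | yes r≤s = begin
      ∑ (λ t → g (toℕ t))                 ≈⟨ ∑-window N g (toℕ r) m r+m<N below above ⟩
      sumUpTo K m (λ u → g (toℕ r ℕ.+ u))
        ≈⟨ sumUpTo-cong m (λ u → reflexive (≡.cong₂ (λ x y → cc (ι r) x * b x y) (shift-+ (toℕ r) u) ι-s)) ⟩
      sumUpTo K m (λ u → cc (ι r) (ι r ℤ.+ + u) * b (ι r ℤ.+ + u) (ι r ℤ.+ + m)) ≈⟨ proj₂ (proj₂ cc-inverse) (ι r) m ⟩
      δ K m                               ≈⟨ δ≈1ᴹ m r+m≡s ⟩
      1ᴹ r s                              ∎
      where
      g : ℕ → Carrier
      g t = cc (ι r) (shift t) * b (shift t) (ι s)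
      m = toℕ s ∸ toℕ r
      r+m≡s : toℕ r ℕ.+ m ≡ toℕ s
      r+m≡s = ℕₚ.m+[n∸m]≡n r≤s
      r+m<N : toℕ r ℕ.+ m ℕ.< N
      r+m<N = ℕₚ.≤-trans (s≤s (ℕₚ.≤-reflexive r+m≡s)) (Finₚ.toℕ<n s)
      ι-s : ι s ≡ ι r ℤ.+ + m
      ι-s = ≡.trans (≡.cong shift (≡.sym r+m≡s)) (shift-+ (toℕ r) m)
      below : ∀ t → t ℕ.< toℕ r → g t ≈ 0#
      below t t<r = trans (*-congʳ (cc-lower≈0 _ _ (shift-< t<r))) (zeroˡ _)
      above : ∀ t → toℕ r ℕ.+ m ℕ.< t → g t ≈ 0#
      above t r+m<t = trans (*-congˡ (proj₁ b-upper _ _ (shift-< (ℕₚ.≤-trans (s≤s (ℕₚ.≤-reflexive (≡.sym r+m≡s))) r+m<t)))) (zeroʳ _)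
    ... | no r≰s = trans (∑-zero term≈0) (sym (1ᴹ-offDiagonal (λ r≡s → r≰s (ℕₚ.≤-reflexive (≡.cong toℕ r≡s)))))
      where
      term≈0 : ∀ t → A′ r t * A t s ≈ 0#
      term≈0 t with toℕ t ℕ.<? toℕ r
      ... | yes t<r = trans (*-congʳ (cc-lower≈0 _ _ (shift-< t<r))) (zeroˡ _)
      ... | no t≮r  = trans (*-congˡ (proj₁ b-upper _ _ (shift-< (ℕₚ.<-≤-trans (ℕₚ.≰⇒> r≰s) (ℕₚ.≮⇒≥ t≮r))))) (zeroʳ _)

    module Minors {lam mu : Fin q → ℕ} (lam-isPartition : IsPartition lam) (mu-isPartition : IsPartition mu)
             (lam≤p : Bounded lam) (mu≤p : Bounded mu) where

      σλ σμ σ∅ : Fin N → Fin N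
      σλ = positions lam≤p
      σμ = positions mu≤p
      σ∅ = positions empty-bounded

      Y : Matrix N
      Y r s = [ (λ _ → A r (σλ s)) , (λ _ → 1ᴹ r (σμ s)) ]′ (splitAt q s)

      Y-↑ˡ : ∀ r j → Y r (j ↑ˡ p) ≡ A r (σλ (j ↑ˡ p))
      Y-↑ˡ r j = ≡.cong [ (λ _ → A r (σλ (j ↑ˡ p))) , (λ _ → 1ᴹ r (σμ (j ↑ˡ p))) ]′ (Finₚ.splitAt-↑ˡ q j p)

      Y-↑ʳ : ∀ r k → Y r (q ↑ʳ k) ≡ 1ᴹ r (σμ (q ↑ʳ k))
      Y-↑ʳ r k = ≡.cong [ (λ _ → A r (σλ (q ↑ʳ k))) , (λ _ → 1ᴹ r (σμ (q ↑ʳ k))) ]′ (Finₚ.splitAt-↑ʳ q p k)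

      leftMinor : Matrix q
      leftMinor i j = A (σμ (i ↑ˡ p)) (σλ (j ↑ˡ p))

      rightMinor : Matrix p
      rightMinor l k = A′ (σλ (q ↑ʳ l)) (σμ (q ↑ʳ k))

      det-Y∘σμ : det K N (Y ∘ σμ) ≈ det K q leftMinor
      det-Y∘σμ = det-upperLeftBlock q p leftMinor (Y ∘ σμ)
        (λ i j → reflexive (Y-↑ˡ _ j))
        (λ i k → trans (reflexive (Y-↑ʳ _ k)) (trans (1ᴹ-σμ _ _) (1ᴹ-offDiagonal (↑ˡ≢↑ʳ i k))))
        (λ l k → trans (reflexive (Y-↑ʳ _ k)) (trans (1ᴹ-σμ _ _) (1ᴹ-reindex (Finₚ.↑ʳ-injective q _ _) l k)))
        where
        1ᴹ-σμ = 1ᴹ-reindex (positions-injective mu-isPartition mu≤p)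

      A′Y-↑ˡ : ∀ r j → (A′ *ᴹ Y) r (j ↑ˡ p) ≈ 1ᴹ r (σλ (j ↑ˡ p))
      A′Y-↑ˡ r j = trans (∑-cong (λ t → *-congˡ (reflexive (Y-↑ˡ t j)))) (A′*A≈1 r (σλ (j ↑ˡ p)))

      A′Y-↑ʳ : ∀ r k → (A′ *ᴹ Y) r (q ↑ʳ k) ≈ A′ r (σμ (q ↑ʳ k))
      A′Y-↑ʳ r k = trans (∑-cong (λ t → *-congˡ (reflexive (Y-↑ʳ t k)))) (*ᴹ-identityʳ A′ r (σμ (q ↑ʳ k)))

      det-A′Y∘σλ : det K N ((A′ *ᴹ Y) ∘ σλ) ≈ det K p rightMinor
      det-A′Y∘σλ = det-lowerRightBlock q p rightMinor ((A′ *ᴹ Y) ∘ σλ)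
        (λ i j → trans (A′Y-↑ˡ _ j) (trans (1ᴹ-σλ _ _) (1ᴹ-reindex (Finₚ.↑ˡ-injective p _ _) i j)))
        (λ l j → trans (A′Y-↑ˡ _ j) (trans (1ᴹ-σλ _ _) (1ᴹ-offDiagonal (↑ˡ≢↑ʳ j l ∘ ≡.sym))))
        (λ l k → A′Y-↑ʳ _ k)
        where
        1ᴹ-σλ = 1ᴹ-reindex (positions-injective lam-isPartition lam≤p)

      complementaryMinors : det K q leftMinor ≈ sign (sumFin lam ℕ.+ sumFin mu) * det K p rightMinor
      complementaryMinors = begin
        det K q leftMinor                                   ≈⟨ det-Y∘σμ ⟨
        det K N (Y ∘ σμ)                                    ≈⟨ det-∘positions _ mu-isPartition mu≤p ≡.refl Y ⟩
        sign |μ| * det K N (Y ∘ σ∅)                         ≈⟨ *-congˡ (det-permuteRows N σ∅ Y) ⟩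
        sign |μ| * (ε * det K N Y)                          ≈⟨ sign-+-cancelˡ |λ| |μ| _ ⟨
        sign (|λ| ℕ.+ |μ|) * (sign |λ| * (ε * det K N Y))   ≈⟨ *-congˡ (*-congˡ (*-congˡ detA′Y≈detY)) ⟨
        sign (|λ| ℕ.+ |μ|) * (sign |λ| * (ε * det K N (A′ *ᴹ Y)))
          ≈⟨ *-congˡ (*-congˡ (det-permuteRows N σ∅ (A′ *ᴹ Y))) ⟨
        sign (|λ| ℕ.+ |μ|) * (sign |λ| * det K N ((A′ *ᴹ Y) ∘ σ∅))
          ≈⟨ *-congˡ (det-∘positions _ lam-isPartition lam≤p ≡.refl (A′ *ᴹ Y)) ⟨
        sign (|λ| ℕ.+ |μ|) * det K N ((A′ *ᴹ Y) ∘ σλ)       ≈⟨ *-congˡ det-A′Y∘σλ ⟩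
        sign (|λ| ℕ.+ |μ|) * det K p rightMinor             ∎
        where
        |λ| = sumFin lam
        |μ| = sumFin mu
        ε = det K N (1ᴹ ∘ σ∅)
        detA′Y≈detY : det K N (A′ *ᴹ Y) ≈ det K N Y
        detA′Y≈detY = trans (det-*ᴹ N A′ Y) (trans (*-congʳ det-A′) (*-identityˡ _))


mainTheorem3 : ∀ {c ℓ : Level} (p q : ℕ) (lam mu : Fin q → ℕ) →
    IsPartition lam → IsPartition mu →
    (∀ j → lam j ℕ.≤ p) → (∀ j → mu j ℕ.≤ p) →
    (K : CommutativeRing c ℓ) (b cc : ZMatrix K) →
    IsUpperUnitriangular K b → IsInverse K b cc →
    CommutativeRing._≈_ K
      (det K q (λ i j → b (+ mu i ℤ.- + suc (toℕ i)) (+ lam j ℤ.- + suc (toℕ j))))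
      (CommutativeRing._*_ K (neg1^ K (sumFin lam ℕ.+ sumFin mu))
        (det K p (λ i j → cc (+ suc (toℕ i) ℤ.- + conj p lam i ℤ.- + 1)
                             (+ suc (toℕ j) ℤ.- + conj p mu j ℤ.- + 1))))
mainTheorem3 p q lam mu lam-isPartition mu-isPartition lam≤p mu≤p K b cc b-upper cc-inverse = begin
  det K q (λ i j → b (+ mu i ℤ.- + suc (toℕ i)) (+ lam j ℤ.- + suc (toℕ j)))
    ≈⟨ det-cong q (λ i j → reflexive (≡.cong₂ b (≡.sym (ι-positions-↑ˡ mu≤p i)) (≡.sym (ι-positions-↑ˡ lam≤p j)))) ⟩
  det K q leftMinor
    ≈⟨ complementaryMinors ⟩
  sign (sumFin lam ℕ.+ sumFin mu) * det K p rightMinor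
    ≈⟨ *-congˡ (det-cong p (λ l k → reflexive (≡.cong₂ cc (ι-positions-↑ʳ lam≤p l) (ι-positions-↑ʳ mu≤p k)))) ⟩
  sign (sumFin lam ℕ.+ sumFin mu) * det K p (λ i j → cc (+ suc (toℕ i) ℤ.- + conj p lam i ℤ.- + 1)
                                                       (+ suc (toℕ j) ℤ.- + conj p mu j ℤ.- + 1)) ∎
  where
  open CommutativeRing K using (_*_; reflexive; *-congˡ; setoid)
  open import Relation.Binary.Reasoning.Setoid setoid
  open Determinant K using (sign; det-cong)
  open ComplementaryMinors K q p
  open Window b cc b-upper cc-inverse
  open Minors lam-isPartition mu-isPartition lam≤p mu≤p
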